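{- For $n\ge0$ let $A_n$ be the set of inversion sequences $e\in\mathbf{I}_n$ having no index $i$ with $e_i>e_{i+1}\le e_{i+2}$. Then $$\sum_{n\ge0}\sum_{e\in A_n}z^nt^{\mathrm{dist}(e)}=\frac{1+z(3-t)-\sqrt{1-z(2+2t-z+6zt-zt^2)}}{4z}.$$
   Context: An inversion sequence of length $n$ is an integer sequence $e=e_1\dots e_n$ with $0\le e_i<i$ for all $i$; $\mathbf{I}_n$ is the set of these, and $\mathbf{I}_0$ consists only of the empty sequence. For $e\in\mathbf{I}_n$, $\mathrm{dist}(e)=|\{e_1,\dots,e_n\}|$ is the number of distinct entries (so $\mathrm{dist}$ of the empty sequence is $0$). In the paper's notation $A_n=\mathbf{I}_n(\underline{>,\leq})$. -}

module Defs where

open import Data.Bool using (Bool; true; false; _∧_; _∨_; not)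
open import Data.Nat using (ℕ; zero; suc; _∸_; _<ᵇ_; _≤ᵇ_; _≡ᵇ_)
open import Data.Integer using (ℤ; +_; _+_; _*_; -_)
open import Data.List using (List; []; _∷_; _++_; [_]; map; concatMap; upTo; length; filterᵇ; deduplicate; foldr)
open import Data.Nat.Properties using (_≟_)

-- Inversion sequences (as lists e₁ … eₙ with 0 ≤ eᵢ < i)

I : ℕ → List (List ℕ)
I zero    = [] ∷ []
I (suc n) = concatMap (λ e → map (λ x → e ++ [ x ]) (upTo (suc n))) (I n)

hasPattern : List ℕ → Bool
hasPattern (x ∷ y ∷ w ∷ r) = ((y <ᵇ x) ∧ (y ≤ᵇ w)) ∨ hasPattern (y ∷ w ∷ r)
hasPattern _ = false

A : ℕ → List (List ℕ)
A n = filterᵇ (λ e → not (hasPattern e)) (I n)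

dist : List ℕ → ℕ
dist e = length (deduplicate _≟_ e)

a : ℕ → ℕ → ℕ
a n k = length (filterᵇ (λ e → dist e ≡ᵇ k) (A n))

-- Formal power series in z, t over ℤ:  f n k = coefficient of z^n t^k

Ser : Set
Ser = ℕ → ℕ → ℤ

sumℤ : List ℤ → ℤ
sumℤ = foldr _+_ (+ 0)

infixl 6 _⊕_ _⊖_
infixl 7 _⊛_
infix 4 _≈ˢ_

_⊕_ : Ser → Ser → Ser
(f ⊕ g) n k = f n k + g n k

_⊖_ : Ser → Ser → Ser
(f ⊖ g) n k = f n k + - (g n k)

_⊛_ : Ser → Ser → Ser
(f ⊛ g) n k = sumℤ (map (λ i → sumℤ (map (λ j → f i j * g (n ∸ i) (k ∸ j)) (upTo (suc k)))) (upTo (suc n)))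

const : ℤ → Ser
const c zero zero = c
const c _ _ = + 0

zS : Ser
zS (suc zero) zero = + 1
zS _ _ = + 0

tS : Ser
tS zero (suc zero) = + 1
tS _ _ = + 0

F : Ser
F n k = + (a n k)

_≈ˢ_ : Ser → Ser → Set
f ≈ˢ g = ∀ n k → f n k ≡ g n k
  where open import Relation.Binary.PropositionalEquality using (_≡_)

Rad : Ser
Rad = const (+ 1) ⊖ zS ⊛ (const (+ 2) ⊕ const (+ 2) ⊛ tS ⊖ zS ⊕ const (+ 6) ⊛ zS ⊛ tS ⊖ zS ⊛ tS ⊛ tS)

Num : Ser
Num = const (+ 1) ⊕ zS ⊛ (const (+ 3) ⊖ tS)

-- After its first descent such a sequence must decrease strictly, so it is a
-- weakly increasing prefix w followed by a strictly decreasing tail below the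
-- last entry of w; the tails of w have generating function ∏_{y<last}(1 + z t^[y∉w]).
-- Hence F = 1 + tB, B the series of all prefixes w with their tails.  Grouping
-- the prefixes by height |w| - last(w) gives linear recursions for series N_h,
-- M_h; the kernel method (by order in z) yields N_{h+1} = X N_h, M_{h+1} = X M_h
-- for X = N_1, so X and then B satisfy quadratic equations, and
-- (1 + z(3-t) - 4zF)² = Rad.  Square roots with constant term 1 are unique.
module Submission where

open import Defs
open import Algebra.Bundles using (CommutativeRing)
open import Data.Nat as ℕ
  using (ℕ; zero; suc; _∸_; _≤_; _<_; z≤n; s≤s; _≡ᵇ_; _<ᵇ_; _≤ᵇ_)
import Data.Nat.Properties as ℕP
open import Data.Bool using (Bool; true; false; _∧_; _∨_; not; if_then_else_; T)
import Data.Bool.Properties as BP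
import Data.Integer as ℤ
open import Data.Integer using (ℤ; +_; -[1+_])
  renaming (_+_ to _+ℤ_; _*_ to _*ℤ_; -_ to -ℤ_)
import Data.Integer.Properties as ℤP
open import Data.List using (List; []; _∷_; _++_; [_]; map; concatMap; upTo; length; filter; filterᵇ; deduplicate)
import Data.List.Properties as LP
open import Data.Product using (_×_; _,_; proj₁; proj₂; ∃)
open import Data.Sum using (inj₁; inj₂)
open import Data.Empty using (⊥-elim)
open import Function.Bundles using (Equivalence)
open import Relation.Binary.PropositionalEquality as P
  using (_≡_; _≢_; cong; cong₂)
open import Relation.Nullary using (yes; no; ¬?)
open import Relation.Binary using (tri<; tri≈; tri>)

module Comparisons where
  open P using (refl)

  true⇒T : ∀ {b} → b ≡ true → T b
  true⇒T = Equivalence.from BP.T-≡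

  T⇒true : ∀ {b} → T b → b ≡ true
  T⇒true = Equivalence.to BP.T-≡

  ≡ᵇ-sound : ∀ m n → (m ≡ᵇ n) ≡ true → m ≡ n
  ≡ᵇ-sound m n e = ℕP.≡ᵇ⇒≡ m n (true⇒T e)

  ≡ᵇ-refl : ∀ m → (m ≡ᵇ m) ≡ true
  ≡ᵇ-refl m = T⇒true (ℕP.≡⇒≡ᵇ m m refl)

  ≡ᵇ-false : ∀ {m n} → m ≢ n → (m ≡ᵇ n) ≡ false
  ≡ᵇ-false {m} {n} m≢n with m ≡ᵇ n in eq
  ... | true  = ⊥-elim (m≢n (≡ᵇ-sound m n eq))
  ... | false = refl

  ≡ᵇ-sym : ∀ m n → (m ≡ᵇ n) ≡ (n ≡ᵇ m)
  ≡ᵇ-sym zero    zero    = refl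
  ≡ᵇ-sym zero    (suc n) = refl
  ≡ᵇ-sym (suc m) zero    = refl
  ≡ᵇ-sym (suc m) (suc n) = ≡ᵇ-sym m n

  <⇒≡ᵇ-false : ∀ {m n} → m < n → (m ≡ᵇ n) ≡ false
  <⇒≡ᵇ-false m<n = ≡ᵇ-false (ℕP.<⇒≢ m<n)

  >⇒≡ᵇ-false : ∀ {m n} → n < m → (m ≡ᵇ n) ≡ false
  >⇒≡ᵇ-false n<m = ≡ᵇ-false (ℕP.>⇒≢ n<m)

  <ᵇ-true : ∀ {m n} → m < n → (m <ᵇ n) ≡ true
  <ᵇ-true m<n = T⇒true (ℕP.<⇒<ᵇ m<n)

  <ᵇ-false : ∀ {m n} → n ≤ m → (m <ᵇ n) ≡ false
  <ᵇ-false {m} {n} n≤m with m <ᵇ n in eq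
  ... | true  = ⊥-elim (ℕP.<⇒≱ (ℕP.<ᵇ⇒< m n (true⇒T eq)) n≤m)
  ... | false = refl

  ≤ᵇ-sound : ∀ m n → (m ≤ᵇ n) ≡ true → m ≤ n
  ≤ᵇ-sound m n e = ℕP.≤ᵇ⇒≤ m n (true⇒T e)

  ≤ᵇ-true : ∀ {m n} → m ≤ n → (m ≤ᵇ n) ≡ true
  ≤ᵇ-true m≤n = T⇒true (ℕP.≤⇒≤ᵇ m≤n)

  ≤ᵇ-false : ∀ {m n} → n < m → (m ≤ᵇ n) ≡ false
  ≤ᵇ-false {m} {n} n<m with m ≤ᵇ n in eq
  ... | true  = ⊥-elim (ℕP.<⇒≱ n<m (≤ᵇ-sound m n eq))
  ... | false = refl

open Comparisons

module Sums {c ℓ} (R : CommutativeRing c ℓ) where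
  open CommutativeRing R
  open import Relation.Binary.Reasoning.Setoid setoid
  open import Algebra.Properties.CommutativeSemigroup +-commutativeSemigroup
    using (interchange)

  Σ : ℕ → (ℕ → Carrier) → Carrier
  Σ zero    f = 0#
  Σ (suc n) f = Σ n f + f n

  Σ-cong : ∀ n {f g} → (∀ i → i < n → f i ≈ g i) → Σ n f ≈ Σ n g
  Σ-cong zero    h = refl
  Σ-cong (suc n) h = +-cong (Σ-cong n (λ i i<n → h i (ℕP.m<n⇒m<1+n i<n))) (h n ℕP.≤-refl)

  Σ-cong′ : ∀ n {f g} → (∀ i → f i ≈ g i) → Σ n f ≈ Σ n g
  Σ-cong′ n h = Σ-cong n (λ i _ → h i)

  Σ-zeroes : ∀ n {f} → (∀ i → i < n → f i ≈ 0#) → Σ n f ≈ 0#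
  Σ-zeroes zero    h = refl
  Σ-zeroes (suc n) h =
    trans (+-cong (Σ-zeroes n (λ i i<n → h i (ℕP.m<n⇒m<1+n i<n))) (h n ℕP.≤-refl)) (+-identityʳ _)

  Σ-+ : ∀ n f g → Σ n (λ i → f i + g i) ≈ Σ n f + Σ n g
  Σ-+ zero    f g = sym (+-identityʳ _)
  Σ-+ (suc n) f g = trans (+-cong (Σ-+ n f g) refl) (interchange _ _ _ _)

  Σ-*ˡ : ∀ n a f → a * Σ n f ≈ Σ n (λ i → a * f i)
  Σ-*ˡ zero    a f = zeroʳ a
  Σ-*ˡ (suc n) a f = trans (distribˡ _ _ _) (+-cong (Σ-*ˡ n a f) refl)

  Σ-*ʳ : ∀ n a f → Σ n f * a ≈ Σ n (λ i → f i * a)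
  Σ-*ʳ n a f = trans (*-comm _ _) (trans (Σ-*ˡ n a f) (Σ-cong′ n (λ i → *-comm _ _)))

  Σ-first : ∀ n f → Σ (suc n) f ≈ f 0 + Σ n (λ i → f (suc i))
  Σ-first zero    f = trans (+-identityˡ _) (sym (+-identityʳ _))
  Σ-first (suc n) f = trans (+-cong (Σ-first n f) refl) (+-assoc _ _ _)

  Σ-lead : ∀ n f → (∀ i → i < n → f (suc i) ≈ 0#) → Σ (suc n) f ≈ f 0
  Σ-lead n f h = trans (Σ-first n f) (trans (+-cong refl (Σ-zeroes n h)) (+-identityʳ _))

  Σ-rev : ∀ n f → Σ n f ≈ Σ n (λ i → f (n ∸ suc i))
  Σ-rev zero    f = refl
  Σ-rev (suc n) f = begin
    Σ n f + f n                                 ≈⟨ +-comm _ _ ⟩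
    f n + Σ n f                                 ≈⟨ +-cong refl (Σ-rev n f) ⟩
    f n + Σ n (λ i → f (n ∸ suc i))             ≈⟨ sym (Σ-first n (λ i → f (n ∸ i))) ⟩
    Σ (suc n) (λ i → f (n ∸ i))                 ∎

  Σ-split : ∀ a b f → Σ (a ℕ.+ b) f ≈ Σ a f + Σ b (λ s → f (a ℕ.+ s))
  Σ-split a zero    f = trans (reflexive (cong (λ m → Σ m f) (ℕP.+-identityʳ a))) (sym (+-identityʳ _))
  Σ-split a (suc b) f = begin
    Σ (a ℕ.+ suc b) f                                       ≈⟨ reflexive (cong (λ m → Σ m f) (ℕP.+-suc a b)) ⟩
    Σ (a ℕ.+ b) f + f (a ℕ.+ b)                             ≈⟨ +-cong (Σ-split a b f) refl ⟩
    (Σ a f + Σ b (λ s → f (a ℕ.+ s))) + f (a ℕ.+ b)         ≈⟨ +-assoc _ _ _ ⟩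
    Σ a f + Σ (suc b) (λ s → f (a ℕ.+ s))                   ∎

  Σ-split-at : ∀ y m f → y ≤ m → Σ m f ≈ Σ y f + Σ (m ∸ y) (λ s → f (y ℕ.+ s))
  Σ-split-at y m f y≤m =
    trans (reflexive (cong (λ k → Σ k f) (P.sym (ℕP.m+[n∸m]≡n y≤m)))) (Σ-split y (m ∸ y) f)

  Σ-truncate : ∀ a b f → a ≤ b → (∀ j → a ≤ j → f j ≈ 0#) → Σ b f ≈ Σ a f
  Σ-truncate a b f a≤b h =
    trans (Σ-split-at a b f a≤b)
          (trans (+-cong refl (Σ-zeroes (b ∸ a) (λ s _ → h (a ℕ.+ s) (ℕP.m≤m+n a s)))) (+-identityʳ _))

  Σ-swap : ∀ a b (f : ℕ → ℕ → Carrier) → Σ a (λ i → Σ b (f i)) ≈ Σ b (λ j → Σ a (λ i → f i j))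
  Σ-swap zero    b f = sym (Σ-zeroes b (λ _ _ → refl))
  Σ-swap (suc a) b f = trans (+-cong (Σ-swap a b f) refl) (sym (Σ-+ b _ _))

  Σ-triangle : ∀ n (g : ℕ → ℕ → Carrier) →
    Σ (suc n) (λ i → Σ (suc i) (λ j → g j (i ∸ j))) ≈ Σ (suc n) (λ j → Σ (suc (n ∸ j)) (g j))
  Σ-triangle zero    g = refl
  Σ-triangle (suc n) g = begin
    Σ (suc n) (λ i → Σ (suc i) (λ j → g j (i ∸ j))) + (Σ (suc n) (λ j → g j (suc n ∸ j)) + g (suc n) (n ∸ n))
      ≈⟨ +-cong (Σ-triangle n g) refl ⟩
    Σ (suc n) (λ j → Σ (suc (n ∸ j)) (g j)) + (Σ (suc n) (λ j → g j (suc n ∸ j)) + g (suc n) (n ∸ n))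
      ≈⟨ sym (+-assoc _ _ _) ⟩
    (Σ (suc n) (λ j → Σ (suc (n ∸ j)) (g j)) + Σ (suc n) (λ j → g j (suc n ∸ j))) + g (suc n) (n ∸ n)
      ≈⟨ +-cong (sym (Σ-+ (suc n) _ _)) (last (ℕP.n∸n≡0 n)) ⟩
    Σ (suc n) (λ j → Σ (suc (n ∸ j)) (g j) + g j (suc n ∸ j)) + Σ (suc (suc n ∸ suc n)) (g (suc n))
      ≈⟨ +-cong (Σ-cong (suc n) grow) refl ⟩
    Σ (suc n) (λ j → Σ (suc (suc n ∸ j)) (g j)) + Σ (suc (suc n ∸ suc n)) (g (suc n)) ∎
    where
    last : ∀ {m} → m ≡ 0 → g (suc n) m ≈ Σ (suc m) (g (suc n))
    last P.refl = sym (+-identityˡ _)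
    grow : ∀ j → j < suc n → Σ (suc (n ∸ j)) (g j) + g j (suc n ∸ j) ≈ Σ (suc (suc n ∸ j)) (g j)
    grow j (s≤s j≤n) rewrite ℕP.+-∸-assoc 1 j≤n = refl

  when : Bool → Carrier → Carrier
  when b x = if b then x else 0#

  when-true : ∀ {b} x → b ≡ true → when b x ≈ x
  when-true x P.refl = refl

  when-false : ∀ {b} x → b ≡ false → when b x ≈ 0#
  when-false x P.refl = refl

  when-cong : ∀ b {x y} → x ≈ y → when b x ≈ when b y
  when-cong true  x≈y = x≈y
  when-cong false x≈y = refl

  when-*ˡ : ∀ b a x → when b (a * x) ≈ a * when b x
  when-*ˡ true  a x = refl
  when-*ˡ false a x = sym (zeroʳ a)

  when-1 : ∀ b x → x * when b 1# ≈ when b x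
  when-1 true  x = *-identityʳ x
  when-1 false x = zeroʳ x

  Σ-delta : ∀ N k (f : ℕ → Carrier) → Σ N (λ y → when (y ≡ᵇ k) (f y)) ≈ when (k <ᵇ N) (f k)
  Σ-delta zero    k f = refl
  Σ-delta (suc N) k f with ℕP.<-cmp N k
  ... | tri< N<k _ _ = begin
    Σ N (λ y → when (y ≡ᵇ k) (f y)) + when (N ≡ᵇ k) (f N)
      ≈⟨ +-cong (trans (Σ-delta N k f) (when-false _ (<ᵇ-false (ℕP.<⇒≤ N<k)))) (when-false _ (<⇒≡ᵇ-false N<k)) ⟩
    0# + 0#                      ≈⟨ +-identityʳ _ ⟩
    0#                           ≈⟨ sym (when-false _ (<ᵇ-false N<k)) ⟩
    when (k <ᵇ suc N) (f k)      ∎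
  ... | tri≈ _ P.refl _ = begin
    Σ N (λ y → when (y ≡ᵇ N) (f y)) + when (N ≡ᵇ N) (f N)
      ≈⟨ +-cong (trans (Σ-delta N N f) (when-false _ (<ᵇ-false (ℕP.≤-refl {N})))) (when-true _ (≡ᵇ-refl N)) ⟩
    0# + f N                     ≈⟨ +-identityˡ _ ⟩
    f N                          ≈⟨ sym (when-true _ (<ᵇ-true (ℕP.n<1+n N))) ⟩
    when (N <ᵇ suc N) (f N)      ∎
  ... | tri> _ _ k<N = begin
    Σ N (λ y → when (y ≡ᵇ k) (f y)) + when (N ≡ᵇ k) (f N)
      ≈⟨ +-cong (trans (Σ-delta N k f) (when-true _ (<ᵇ-true k<N))) (when-false _ (>⇒≡ᵇ-false k<N)) ⟩
    f k + 0#                     ≈⟨ +-identityʳ _ ⟩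
    f k                          ≈⟨ sym (when-true _ (<ᵇ-true (ℕP.m<n⇒m<1+n k<N))) ⟩
    when (k <ᵇ suc N) (f k)      ∎

  ΣL : {A : Set} → List A → (A → Carrier) → Carrier
  ΣL []       f = 0#
  ΣL (x ∷ xs) f = f x + ΣL xs f

  ΣL-cong : {A : Set} (xs : List A) {f g : A → Carrier} → (∀ x → f x ≈ g x) → ΣL xs f ≈ ΣL xs g
  ΣL-cong []       h = refl
  ΣL-cong (x ∷ xs) h = +-cong (h x) (ΣL-cong xs h)

  ΣL-zeroes : {A : Set} (xs : List A) {f : A → Carrier} → (∀ x → f x ≈ 0#) → ΣL xs f ≈ 0#
  ΣL-zeroes []       h = refl
  ΣL-zeroes (x ∷ xs) h = trans (+-cong (h x) (ΣL-zeroes xs h)) (+-identityʳ _)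

  ΣL-+ : {A : Set} (xs : List A) (f g : A → Carrier) → ΣL xs (λ x → f x + g x) ≈ ΣL xs f + ΣL xs g
  ΣL-+ []       f g = sym (+-identityʳ _)
  ΣL-+ (x ∷ xs) f g = trans (+-cong refl (ΣL-+ xs f g)) (interchange _ _ _ _)

  ΣL-*ˡ : {A : Set} (xs : List A) (a : Carrier) (f : A → Carrier) → a * ΣL xs f ≈ ΣL xs (λ x → a * f x)
  ΣL-*ˡ []       a f = zeroʳ a
  ΣL-*ˡ (x ∷ xs) a f = trans (distribˡ _ _ _) (+-cong refl (ΣL-*ˡ xs a f))

  ΣL-++ : {A : Set} (xs ys : List A) (f : A → Carrier) → ΣL (xs ++ ys) f ≈ ΣL xs f + ΣL ys f
  ΣL-++ []       ys f = sym (+-identityˡ _)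
  ΣL-++ (x ∷ xs) ys f = trans (+-cong refl (ΣL-++ xs ys f)) (sym (+-assoc _ _ _))

  ΣL-map : {A B : Set} (g : A → B) (xs : List A) (f : B → Carrier) → ΣL (map g xs) f ≈ ΣL xs (λ x → f (g x))
  ΣL-map g []       f = refl
  ΣL-map g (x ∷ xs) f = +-cong refl (ΣL-map g xs f)

  ΣL-concatMap : {A B : Set} (g : A → List B) (xs : List A) (f : B → Carrier) →
    ΣL (concatMap g xs) f ≈ ΣL xs (λ x → ΣL (g x) f)
  ΣL-concatMap g []       f = refl
  ΣL-concatMap g (x ∷ xs) f = trans (ΣL-++ (g x) _ f) (+-cong refl (ΣL-concatMap g xs f))

  ΣL-upTo : ∀ n f → ΣL (upTo n) f ≈ Σ n f
  ΣL-upTo zero    f = refl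
  ΣL-upTo (suc n) f = begin
    ΣL (upTo (suc n)) f       ≈⟨ reflexive (cong (λ l → ΣL l f) (P.sym (LP.upTo-∷ʳ n))) ⟩
    ΣL (upTo n ++ [ n ]) f    ≈⟨ ΣL-++ (upTo n) [ n ] f ⟩
    ΣL (upTo n) f + (f n + 0#) ≈⟨ +-cong (ΣL-upTo n f) (+-identityʳ _) ⟩
    Σ n f + f n               ∎

  Σ-ΣL : ∀ n {A : Set} (xs : List A) (g : ℕ → A → Carrier) →
    Σ n (λ h → ΣL xs (g h)) ≈ ΣL xs (λ x → Σ n (λ h → g h x))
  Σ-ΣL n []       g = Σ-zeroes n (λ _ _ → refl)
  Σ-ΣL n (x ∷ xs) g = trans (Σ-+ n _ _) (+-cong refl (Σ-ΣL n xs g))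

  ΣI-suc : ∀ l (g : List ℕ → Carrier) → ΣL (I (suc l)) g ≈ ΣL (I l) (λ e → Σ (suc l) (λ x → g (e ++ [ x ])))
  ΣI-suc l g = trans (ΣL-concatMap (λ e → map (λ x → e ++ [ x ]) (upTo (suc l))) (I l) g)
    (ΣL-cong (I l) (λ e → trans (ΣL-map (λ x → e ++ [ x ]) (upTo (suc l)) g) (ΣL-upTo (suc l) (λ x → g (e ++ [ x ])))))

module PowerSeries {c ℓ} (R : CommutativeRing c ℓ) where
  open CommutativeRing R
  open Sums R public
  open import Relation.Binary.Reasoning.Setoid setoid
  open import Algebra.Structures using (IsCommutativeRing)
  open import Algebra.Properties.Ring ring using (-0#≈0#)

  Series : Set c
  Series = ℕ → Carrier

  _≋_ : Series → Series → Set ℓ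
  f ≋ g = ∀ n → f n ≈ g n

  0ₛ : Series
  0ₛ n = 0#

  1ₛ : Series
  1ₛ zero    = 1#
  1ₛ (suc n) = 0#

  constant : Carrier → Series
  constant a zero    = a
  constant a (suc n) = 0#

  var : Series
  var (suc zero) = 1#
  var _          = 0#

  constant-cong : ∀ {a b} → a ≈ b → constant a ≋ constant b
  constant-cong a≈b zero    = a≈b
  constant-cong a≈b (suc n) = refl

  -- The operations are opaque, so that normalising ring-solver goals never
  -- unfolds a convolution; the lemmas ⊹-eq, neg-eq and conv-eq give access
  -- to their definitions.
  opaque
    _⊹_ : Series → Series → Series
    (f ⊹ g) n = f n + g n

    neg : Series → Series
    neg f n = - f n

    conv : Series → Series → Series
    conv f g n = Σ (suc n) (λ i → f i * g (n ∸ i))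

    ⊹-eq : ∀ f g n → (f ⊹ g) n ≡ f n + g n
    ⊹-eq f g n = P.refl

    neg-eq : ∀ f n → neg f n ≡ - f n
    neg-eq f n = P.refl

    conv-eq : ∀ f g n → conv f g n ≡ Σ (suc n) (λ i → f i * g (n ∸ i))
    conv-eq f g n = P.refl

    conv-cong : ∀ {f f′ g g′} → f ≋ f′ → g ≋ g′ → conv f g ≋ conv f′ g′
    conv-cong f≋f′ g≋g′ n = Σ-cong′ (suc n) (λ i → *-cong (f≋f′ i) (g≋g′ (n ∸ i)))

    conv-comm : ∀ f g → conv f g ≋ conv g f
    conv-comm f g n =
      trans (Σ-rev (suc n) _)
            (Σ-cong (suc n) (λ i i<1+n →
              trans (*-cong refl (reflexive (cong g (ℕP.m∸[m∸n]≡n (ℕP.≤-pred i<1+n))))) (*-comm _ _)))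

    conv-assoc : ∀ f g h → conv (conv f g) h ≋ conv f (conv g h)
    conv-assoc f g h n = begin
      Σ (suc n) (λ i → Σ (suc i) (λ j → f j * g (i ∸ j)) * h (n ∸ i))
        ≈⟨ Σ-cong′ (suc n) (λ i → Σ-*ʳ (suc i) _ _) ⟩
      Σ (suc n) (λ i → Σ (suc i) (λ j → f j * g (i ∸ j) * h (n ∸ i)))
        ≈⟨ Σ-cong′ (suc n) (λ i → Σ-cong (suc i) (λ j j<1+i →
             *-cong refl (reflexive (cong (λ m → h (n ∸ m)) (P.sym (ℕP.m+[n∸m]≡n (ℕP.≤-pred j<1+i))))))) ⟩
      Σ (suc n) (λ i → Σ (suc i) (λ j → term j (i ∸ j)))
        ≈⟨ Σ-triangle n term ⟩
      Σ (suc n) (λ j → Σ (suc (n ∸ j)) (term j))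
        ≈⟨ Σ-cong′ (suc n) (λ j → Σ-cong′ (suc (n ∸ j)) (λ l →
             trans (*-assoc _ _ _) (*-cong refl (*-cong refl (reflexive (cong h (P.sym (ℕP.∸-+-assoc n j l)))))))) ⟩
      Σ (suc n) (λ j → Σ (suc (n ∸ j)) (λ l → f j * (g l * h (n ∸ j ∸ l))))
        ≈⟨ Σ-cong′ (suc n) (λ j → sym (Σ-*ˡ (suc (n ∸ j)) _ _)) ⟩
      Σ (suc n) (λ j → f j * Σ (suc (n ∸ j)) (λ l → g l * h (n ∸ j ∸ l))) ∎
      where
      term : ℕ → ℕ → Carrier
      term j l = f j * g l * h (n ∸ (j ℕ.+ l))

    conv-identityˡ : ∀ f → conv 1ₛ f ≋ f
    conv-identityˡ f n =
      trans (Σ-lead n _ (λ i _ → zeroˡ _)) (*-identityˡ _)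

    conv-distribˡ : ∀ f g h → conv f (g ⊹ h) ≋ (conv f g ⊹ conv f h)
    conv-distribˡ f g h n = trans (Σ-cong′ (suc n) (λ i → distribˡ _ _ _)) (Σ-+ (suc n) _ _)

    series-isCommutativeRing : IsCommutativeRing _≋_ _⊹_ conv neg 0ₛ 1ₛ
    series-isCommutativeRing = record
      { isRing = record
        { +-isAbelianGroup = record
          { isGroup = record
            { isMonoid = record
              { isSemigroup = record
                { isMagma = record
                  { isEquivalence = record
                    { refl = λ n → refl ; sym = λ p n → sym (p n) ; trans = λ p q n → trans (p n) (q n) }
                  ; ∙-cong = λ p q n → +-cong (p n) (q n) }
                ; assoc = λ f g h n → +-assoc _ _ _ }
              ; identity = (λ f n → +-identityˡ _) , (λ f n → +-identityʳ _) }
            ; inverse = (λ f n → -‿inverseˡ _) , (λ f n → -‿inverseʳ _)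
            ; ⁻¹-cong = λ p n → -‿cong (p n) }
          ; comm = λ f g n → +-comm _ _ }
        ; *-cong = conv-cong
        ; *-assoc = conv-assoc
        ; *-identity = conv-identityˡ , (λ f n → trans (conv-comm f 1ₛ n) (conv-identityˡ f n))
        ; distrib = conv-distribˡ
                  , (λ f g h n → trans (conv-comm (g ⊹ h) f n)
                                   (trans (conv-distribˡ f g h n) (+-cong (conv-comm f g n) (conv-comm f h n)))) }
      ; *-comm = conv-comm }

    constant-+ : ∀ a b → constant (a + b) ≋ (constant a ⊹ constant b)
    constant-+ a b zero    = refl
    constant-+ a b (suc n) = sym (+-identityʳ _)

    constant-* : ∀ a b → constant (a * b) ≋ conv (constant a) (constant b)
    constant-* a b zero    = sym (+-identityˡ _)
    constant-* a b (suc n) = sym (trans (Σ-lead (suc n) _ (λ i _ → zeroˡ _)) (zeroʳ _))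

    constant-neg : ∀ a → constant (- a) ≋ neg (constant a)
    constant-neg a zero    = refl
    constant-neg a (suc n) = sym -0#≈0#

    conv-var-0 : ∀ f → conv var f 0 ≈ 0#
    conv-var-0 f = trans (+-identityˡ _) (zeroˡ _)

    conv-var-suc : ∀ f n → conv var f (suc n) ≈ f n
    conv-var-suc f n = begin
      conv var f (suc n)                                     ≈⟨ Σ-first (suc n) _ ⟩
      0# * f (suc n) + Σ (suc n) (λ i → var (suc i) * f (n ∸ i))
        ≈⟨ +-cong (zeroˡ _) (Σ-lead n _ (λ i _ → zeroˡ _)) ⟩
      0# + 1# * f n                                          ≈⟨ +-identityˡ _ ⟩
      1# * f n                                               ≈⟨ *-identityˡ _ ⟩
      f n                                                    ∎

  constant-0 : constant 0# ≋ 0ₛ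
  constant-0 zero    = refl
  constant-0 (suc n) = refl

  constant-1 : constant 1# ≋ 1ₛ
  constant-1 zero    = refl
  constant-1 (suc n) = refl

  seriesRing : CommutativeRing c ℓ
  seriesRing = record { isCommutativeRing = series-isCommutativeRing }

-- The bivariate series of Defs, f n k = [zⁿ tᵏ] f, are the ring
-- ℤ⟦t⟧⟦z⟧: series in z whose coefficients are series in t.

module Bivariate where
  open P using (refl)

  ℤ-ring : CommutativeRing _ _
  ℤ-ring = ℤP.+-*-commutativeRing

  module S1 = PowerSeries ℤ-ring
  ℤ⟦t⟧ : CommutativeRing _ _
  ℤ⟦t⟧ = S1.seriesRing
  module S2 = PowerSeries ℤ⟦t⟧
  ℤ⟦t,z⟧ : CommutativeRing _ _
  ℤ⟦t,z⟧ = S2.seriesRing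

  module SΣ = Sums ℤ⟦t,z⟧

  module Q = CommutativeRing ℤ⟦t⟧
  module R = CommutativeRing ℤ⟦t,z⟧
  open Q public using (0#; 1#) renaming (_≈_ to _≈₁_; _+_ to _⊞_; _*_ to _⊠_)
  open R public using () renaming (_≈_ to _≋_; _+_ to _⊕′_; _*_ to _⊛′_; -_ to ⊝_; 0# to 0ₛ; 1# to 1ₛ)

  T₁ : Q.Carrier
  T₁ = S1.var

  T₂ : Ser
  T₂ = S2.constant T₁

  Z : Ser
  Z = S2.var

  sumℤ-++ : ∀ xs ys → sumℤ (xs ++ ys) ≡ sumℤ xs +ℤ sumℤ ys
  sumℤ-++ []       ys = P.sym (ℤP.+-identityˡ _)
  sumℤ-++ (x ∷ xs) ys = P.trans (cong (x +ℤ_) (sumℤ-++ xs ys)) (P.sym (ℤP.+-assoc x _ _))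

  sumℤ-upTo : ∀ m (h : ℕ → ℤ) → sumℤ (map h (upTo m)) ≡ S1.Σ m h
  sumℤ-upTo zero    h = refl
  sumℤ-upTo (suc m) h = begin
    sumℤ (map h (upTo (suc m)))               ≡⟨ cong (λ l → sumℤ (map h l)) (P.sym (LP.upTo-∷ʳ m)) ⟩
    sumℤ (map h (upTo m ++ [ m ]))            ≡⟨ cong sumℤ (LP.map-++ h (upTo m) [ m ]) ⟩
    sumℤ (map h (upTo m) ++ [ h m ])          ≡⟨ sumℤ-++ (map h (upTo m)) [ h m ] ⟩
    sumℤ (map h (upTo m)) +ℤ (h m +ℤ + 0)     ≡⟨ cong₂ _+ℤ_ (sumℤ-upTo m h) (ℤP.+-identityʳ _) ⟩
    S1.Σ m h +ℤ h m                           ∎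
    where open P.≡-Reasoning

  coeff-Σ₁ : ∀ m (H : ℕ → Q.Carrier) k → S2.Σ m H k ≡ S1.Σ m (λ i → H i k)
  coeff-Σ₁ zero    H k = refl
  coeff-Σ₁ (suc m) H k = P.trans (S1.⊹-eq (S2.Σ m H) (H m) k) (cong (_+ℤ H m k) (coeff-Σ₁ m H k))

  ⊕≈ : ∀ f g → f ⊕ g ≈ˢ f ⊕′ g
  ⊕≈ f g n k = P.sym (P.trans (cong (λ h → h k) (S2.⊹-eq f g n)) (S1.⊹-eq (f n) (g n) k))

  ⊖≈ : ∀ f g → f ⊖ g ≈ˢ f ⊕′ ⊝ g
  ⊖≈ f g n k = P.sym (begin
    (f ⊕′ ⊝ g) n k            ≡⟨ cong (λ h → h k) (S2.⊹-eq f (⊝ g) n) ⟩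
    (f n Q.+ (⊝ g) n) k       ≡⟨ S1.⊹-eq (f n) ((⊝ g) n) k ⟩
    f n k +ℤ (⊝ g) n k        ≡⟨ cong (λ h → f n k +ℤ h k) (S2.neg-eq g n) ⟩
    f n k +ℤ (Q.- g n) k      ≡⟨ cong (f n k +ℤ_) (S1.neg-eq (g n) k) ⟩
    f n k +ℤ -ℤ g n k         ∎)
    where open P.≡-Reasoning

  ⊛≈ : ∀ f g → f ⊛ g ≈ˢ f ⊛′ g
  ⊛≈ f g n k = begin
    (f ⊛ g) n k
      ≡⟨ cong sumℤ (LP.map-cong (λ i → sumℤ-upTo (suc k) _) (upTo (suc n))) ⟩
    sumℤ (map (λ i → S1.Σ (suc k) (λ j → f i j *ℤ g (n ∸ i) (k ∸ j))) (upTo (suc n)))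
      ≡⟨ sumℤ-upTo (suc n) _ ⟩
    S1.Σ (suc n) (λ i → S1.Σ (suc k) (λ j → f i j *ℤ g (n ∸ i) (k ∸ j)))
      ≡⟨ S1.Σ-cong′ (suc n) (λ i → P.sym (S1.conv-eq (f i) (g (n ∸ i)) k)) ⟩
    S1.Σ (suc n) (λ i → S1.conv (f i) (g (n ∸ i)) k)
      ≡⟨ P.sym (coeff-Σ₁ (suc n) _ k) ⟩
    S2.Σ (suc n) (λ i → S1.conv (f i) (g (n ∸ i))) k
      ≡⟨ cong (λ h → h k) (P.sym (S2.conv-eq f g n)) ⟩
    S2.conv f g n k ∎
    where open P.≡-Reasoning

  zS≈ : zS ≈ˢ Z
  zS≈ zero          k       = refl
  zS≈ (suc zero)    zero    = refl
  zS≈ (suc zero)    (suc k) = refl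
  zS≈ (suc (suc n)) k       = refl

  tS≈ : tS ≈ˢ T₂
  tS≈ zero    zero          = refl
  tS≈ zero    (suc zero)    = refl
  tS≈ zero    (suc (suc k)) = refl
  tS≈ (suc n) k             = refl

  private
    import Algebra.Solver.Ring.AlmostCommutativeRing as ACR
    open import Data.Maybe using (Maybe; just; nothing)

    const≋ : ∀ c → const c ≋ S2.constant (S1.constant c)
    const≋ c zero    zero    = refl
    const≋ c zero    (suc k) = refl
    const≋ c (suc n) k       = refl

    via-constants : ∀ {c e} → S2.constant (S1.constant c) ≋ e → const c ≋ e
    via-constants p = R.trans (const≋ _) p

    const-hom : CommutativeRing.rawRing ℤ-ring ACR.-Raw-AlmostCommutative⟶ ACR.fromCommutativeRing ℤ⟦t,z⟧
    const-hom = record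
      { ⟦_⟧    = const
      ; +-homo = λ a b → via-constants (R.trans (S2.constant-cong (S1.constant-+ a b))
                   (R.trans (S2.constant-+ _ _) (R.+-cong (R.sym (const≋ a)) (R.sym (const≋ b)))))
      ; *-homo = λ a b → via-constants (R.trans (S2.constant-cong (S1.constant-* a b))
                   (R.trans (S2.constant-* _ _) (R.*-cong (R.sym (const≋ a)) (R.sym (const≋ b)))))
      ; -‿homo = λ a → via-constants (R.trans (S2.constant-cong (S1.constant-neg a))
                   (R.trans (S2.constant-neg _) (R.-‿cong (R.sym (const≋ a)))))
      ; 0-homo = via-constants (R.trans (S2.constant-cong S1.constant-0) S2.constant-0)
      ; 1-homo = via-constants (R.trans (S2.constant-cong S1.constant-1) S2.constant-1)
      }

    const-≟ : ∀ (a b : ℤ) → Maybe (const a ≋ const b)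
    const-≟ a b with a ℤP.≟ b
    ... | yes refl = just R.refl
    ... | no _     = nothing

  open import Algebra.Solver.Ring (CommutativeRing.rawRing ℤ-ring) (ACR.fromCommutativeRing ℤ⟦t,z⟧) const-hom const-≟
    public using (solve; _:+_; _:*_; _:-_; :-_; con; _:=_)

  1≋const : 1ₛ ≋ const (+ 1)
  1≋const = R.sym (ACR._-Raw-AlmostCommutative⟶_.1-homo const-hom)

module Coefficients where
  open Bivariate
  open import Relation.Binary.Reasoning.Setoid Q.setoid

  coeff-+ : ∀ A B n → (A ⊕′ B) n ≈₁ A n ⊞ B n
  coeff-+ A B n = Q.reflexive (S2.⊹-eq A B n)

  coeff-* : ∀ A B n → (A ⊛′ B) n ≈₁ S2.Σ (suc n) (λ i → A i ⊠ B (n ∸ i))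
  coeff-* A B n = Q.reflexive (S2.conv-eq A B n)

  coeff-⊝ : ∀ A n → (⊝ A) n ≈₁ Q.- A n
  coeff-⊝ A n = Q.reflexive (S2.neg-eq A n)

  coeff-z*-0 : ∀ A → (Z ⊛′ A) 0 ≈₁ 0#
  coeff-z*-0 = S2.conv-var-0

  coeff-z*-suc : ∀ A n → (Z ⊛′ A) (suc n) ≈₁ A n
  coeff-z*-suc = S2.conv-var-suc

  coeff-constant* : ∀ c A n → (S2.constant c ⊛′ A) n ≈₁ c ⊠ A n
  coeff-constant* c A n = Q.trans (coeff-* _ A n) (S2.Σ-lead n _ (λ i _ → Q.zeroˡ _))

  HasOrder : ℕ → Ser → Set
  HasOrder p A = ∀ m → m < p → A m ≈₁ 0#

  coeff-*-lead : ∀ A B n → HasOrder n B → (A ⊛′ B) n ≈₁ A 0 ⊠ B n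
  coeff-*-lead A B n hB = Q.trans (coeff-* A B n) (Q.trans (S2.Σ-first n _)
    (Q.trans (Q.+-cong Q.refl (S2.Σ-zeroes n (λ i i<n → Q.trans (Q.*-cong Q.refl (hB _ (shrink i<n))) (Q.zeroʳ _))))
             (Q.+-identityʳ _)))
    where
    shrink : ∀ {i n} → i < n → n ∸ suc i < n
    shrink {i} {suc n} _ = s≤s (ℕP.m∸n≤m n i)

  order-* : ∀ {p q} A B → HasOrder p A → HasOrder q B → HasOrder (p ℕ.+ q) (A ⊛′ B)
  order-* {p} {q} A B hA hB m m<p+q = Q.trans (coeff-* A B m) (S2.Σ-zeroes (suc m) term)
    where
    term : ∀ i → i < suc m → A i ⊠ B (m ∸ i) ≈₁ 0#
    term i i≤m with ℕP.<-≤-connex i p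
    ... | inj₁ i<p = Q.trans (Q.*-cong (hA i i<p) Q.refl) (Q.zeroˡ _)
    ... | inj₂ p≤i = Q.trans (Q.*-cong Q.refl (hB (m ∸ i) m∸i<q)) (Q.zeroʳ _)
      where
      p≤m : p ≤ m
      p≤m = ℕP.≤-trans p≤i (ℕP.≤-pred i≤m)
      m∸i<q : m ∸ i < q
      m∸i<q = ℕP.≤-<-trans (ℕP.∸-monoʳ-≤ m p≤i)
                (ℕP.+-cancelˡ-< p (m ∸ p) q (P.subst (_< p ℕ.+ q) (P.sym (ℕP.m+[n∸m]≡n p≤m)) m<p+q))

  coeff-*-zero : ∀ A B n → HasOrder (suc n) B → (A ⊛′ B) n ≈₁ 0#
  coeff-*-zero A B n hB = order-* {0} A B (λ _ ()) hB n (ℕP.n<1+n n)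

  z^ : ℕ → Ser
  z^ zero    = 1ₛ
  z^ (suc l) = Z ⊛′ z^ l

  z^-order : ∀ l A → HasOrder l (z^ l ⊛′ A)
  z^-order (suc l) A zero    _         = Q.trans (R.*-assoc Z (z^ l) A 0) (coeff-z*-0 _)
  z^-order (suc l) A (suc m) (s≤s m<l) =
    Q.trans (R.*-assoc Z (z^ l) A (suc m)) (Q.trans (coeff-z*-suc _ m) (z^-order l A m m<l))

  z^-shift : ∀ l A n → (z^ l ⊛′ A) (l ℕ.+ n) ≈₁ A n
  z^-shift zero    A n = R.*-identityˡ A n
  z^-shift (suc l) A n =
    Q.trans (R.*-assoc Z (z^ l) A (suc (l ℕ.+ n))) (Q.trans (coeff-z*-suc _ (l ℕ.+ n)) (z^-shift l A n))

  coeff-Σ : ∀ m (H : ℕ → Ser) n → SΣ.Σ m H n ≈₁ S2.Σ m (λ i → H i n)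
  coeff-Σ zero    H n = Q.refl
  coeff-Σ (suc m) H n = Q.trans (coeff-+ (SΣ.Σ m H) (H m) n) (Q.+-cong (coeff-Σ m H n) Q.refl)

  coeff-ΣL : ∀ {A : Set} (xs : List A) (H : A → Ser) n → SΣ.ΣL xs H n ≈₁ S2.ΣL xs (λ x → H x n)
  coeff-ΣL []       H n = Q.refl
  coeff-ΣL (x ∷ xs) H n = Q.trans (coeff-+ (H x) (SΣ.ΣL xs H) n) (Q.+-cong Q.refl (coeff-ΣL xs H n))

  -- The sum Σ_j G j of a family with G j = O(z^{j+1}); its coefficient of zⁿ
  -- is the finite sum Σ_{j<n} [zⁿ] G j.
  Σ∞ : (ℕ → Ser) → Ser
  Σ∞ G n = S2.Σ n (λ j → G j n)

  IncreasingOrder : (ℕ → Ser) → Set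
  IncreasingOrder G = ∀ j → HasOrder (suc j) (G j)

  Σ∞-cong : ∀ G G′ → (∀ j → G j ≋ G′ j) → Σ∞ G ≋ Σ∞ G′
  Σ∞-cong G G′ h n = S2.Σ-cong′ n (λ j → h j n)

  Σ∞-+ : ∀ G G′ → Σ∞ (λ j → G j ⊕′ G′ j) ≋ Σ∞ G ⊕′ Σ∞ G′
  Σ∞-+ G G′ n =
    Q.trans (S2.Σ-cong′ n (λ j → coeff-+ (G j) (G′ j) n)) (Q.trans (S2.Σ-+ n _ _) (Q.sym (coeff-+ (Σ∞ G) (Σ∞ G′) n)))

  Σ∞-*ˡ : ∀ c G → IncreasingOrder G → Σ∞ (λ j → c ⊛′ G j) ≋ c ⊛′ Σ∞ G
  Σ∞-*ˡ c G ordG n = begin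
    S2.Σ n (λ j → (c ⊛′ G j) n)                                ≈⟨ S2.Σ-cong′ n (λ j → coeff-* c (G j) n) ⟩
    S2.Σ n (λ j → S2.Σ (suc n) (λ i → c i ⊠ G j (n ∸ i)))      ≈⟨ S2.Σ-swap n (suc n) _ ⟩
    S2.Σ (suc n) (λ i → S2.Σ n (λ j → c i ⊠ G j (n ∸ i)))
      ≈⟨ S2.Σ-cong′ (suc n) (λ i → Q.sym (S2.Σ-*ˡ n (c i) _)) ⟩
    S2.Σ (suc n) (λ i → c i ⊠ S2.Σ n (λ j → G j (n ∸ i)))
      ≈⟨ S2.Σ-cong′ (suc n) (λ i → Q.*-cong Q.refl
           (S2.Σ-truncate (n ∸ i) n _ (ℕP.m∸n≤m n i) (λ j n∸i≤j → ordG j (n ∸ i) (s≤s n∸i≤j)))) ⟩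
    S2.Σ (suc n) (λ i → c i ⊠ Σ∞ G (n ∸ i))                    ≈⟨ Q.sym (coeff-* c (Σ∞ G) n) ⟩
    (c ⊛′ Σ∞ G) n                                              ∎

module SquareRoots where
  open Bivariate
  open Coefficients using (coeff-*)
  open import Algebra.Properties.Group (CommutativeRing.+-group ℤ⟦t,z⟧) using (x∙y⁻¹≈ε⇒x≈y; x≈y⇒x∙y⁻¹≈ε)

  coeff₂-* : ∀ A B n k → (A ⊛′ B) n k ≡ S1.Σ (suc n) (λ i → S1.Σ (suc k) (λ l → A i l *ℤ B (n ∸ i) (k ∸ l)))
  coeff₂-* A B n k = P.trans (coeff-* A B n k)
    (P.trans (coeff-Σ₁ (suc n) _ k) (S1.Σ-cong′ (suc n) (λ i → S1.conv-eq (A i) (B (n ∸ i)) k)))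

  -- a series whose constant term is a nonzero integer is not a zero divisor;
  -- by induction on n + k, using [zⁿ tᵏ](D U) = D n k · U 0 0 + (terms of smaller total degree)
  cancel : ∀ D U c .{{_ : ℤ.NonZero c}} → D ⊛′ U ≋ 0ₛ → U 0 0 ≡ c → D ≋ 0ₛ
  cancel D U c DU≋0 U₀₀ n k = bounded (suc (n ℕ.+ k)) n k (ℕP.n<1+n _)
    where
    bounded : ∀ b n k → n ℕ.+ k < b → D n k ≡ + 0
    bounded (suc b) n k n+k<1+b with ℕP.m≤n⇒m<n∨m≡n (ℕP.≤-pred n+k<1+b)
    ... | inj₁ n+k<b  = bounded b n k n+k<b
    ... | inj₂ n+k≡b = ℤP.*-cancelʳ-≡ (D n k) (+ 0) c (P.sym (P.trans (P.sym (DU≋0 n k)) (P.trans (coeff₂-* D U n k) leading)))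
      where
      open P.≡-Reasoning
      smaller : ∀ i l → i ℕ.+ l < n ℕ.+ k → D i l *ℤ U (n ∸ i) (k ∸ l) ≡ + 0
      smaller i l i+l<n+k =
        P.trans (cong (_*ℤ U (n ∸ i) (k ∸ l)) (bounded b i l (P.subst (i ℕ.+ l <_) n+k≡b i+l<n+k)))
                (ℤP.*-zeroˡ (U (n ∸ i) (k ∸ l)))
      leading : S1.Σ (suc n) (λ i → S1.Σ (suc k) (λ l → D i l *ℤ U (n ∸ i) (k ∸ l))) ≡ D n k *ℤ c
      leading = begin
        S1.Σ n (λ i → S1.Σ (suc k) (λ l → D i l *ℤ U (n ∸ i) (k ∸ l)))
          +ℤ (S1.Σ k (λ l → D n l *ℤ U (n ∸ n) (k ∸ l)) +ℤ D n k *ℤ U (n ∸ n) (k ∸ k))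
          ≡⟨ cong₂ _+ℤ_ (S1.Σ-zeroes n (λ i i<n → S1.Σ-zeroes (suc k) (λ l l≤k →
                           smaller i l (ℕP.+-mono-<-≤ i<n (ℕP.≤-pred l≤k)))))
                        (cong (_+ℤ D n k *ℤ U (n ∸ n) (k ∸ k))
                              (S1.Σ-zeroes k (λ l l<k → smaller n l (ℕP.+-monoʳ-< n l<k)))) ⟩
        + 0 +ℤ (+ 0 +ℤ D n k *ℤ U (n ∸ n) (k ∸ k))
          ≡⟨ ℤP.+-identityˡ _ ⟩
        + 0 +ℤ D n k *ℤ U (n ∸ n) (k ∸ k)
          ≡⟨ ℤP.+-identityˡ _ ⟩
        D n k *ℤ U (n ∸ n) (k ∸ k)
          ≡⟨ cong (D n k *ℤ_) (P.trans (cong₂ U (ℕP.n∸n≡0 n) (ℕP.n∸n≡0 k)) U₀₀) ⟩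
        D n k *ℤ c ∎

  -- S² = S′² gives (S - S′)(S + S′) = 0, and S + S′ has constant term 2
  sqrt-unique : ∀ S S′ → S ⊛′ S ≋ S′ ⊛′ S′ → S 0 0 ≡ + 1 → S′ 0 0 ≡ + 1 → S ≋ S′
  sqrt-unique S S′ S²≋S′² S₀₀ S′₀₀ =
    x∙y⁻¹≈ε⇒x≈y S S′ (cancel (S ⊕′ ⊝ S′) (S ⊕′ S′) (+ 2) difference-of-squares sum₀₀)
    where
    difference-of-squares : (S ⊕′ ⊝ S′) ⊛′ (S ⊕′ S′) ≋ 0ₛ
    difference-of-squares =
      R.trans (solve 2 (λ s s′ → (s :- s′) :* (s :+ s′) := s :* s :- s′ :* s′) R.refl S S′)
              (x≈y⇒x∙y⁻¹≈ε S²≋S′²)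
    sum₀₀ : (S ⊕′ S′) 0 0 ≡ + 2
    sum₀₀ = P.trans (cong (λ h → h 0) (S2.⊹-eq S S′ 0))
                    (P.trans (S1.⊹-eq (S 0) (S′ 0) 0) (cong₂ _+ℤ_ S₀₀ S′₀₀))

module Sequences where
  open P using (refl)
  open import Function using (_∘_)

  mem : ℕ → List ℕ → Bool
  mem y []       = false
  mem y (x ∷ xs) = (y ≡ᵇ x) ∨ mem y xs

  mem-snoc : ∀ y e x → mem y (e ++ [ x ]) ≡ mem y e ∨ (y ≡ᵇ x)
  mem-snoc y []      x = BP.∨-identityʳ _
  mem-snoc y (z ∷ e) x = P.trans (cong ((y ≡ᵇ z) ∨_) (mem-snoc y e x)) (P.sym (BP.∨-assoc (y ≡ᵇ z) _ _))

  mem-snoc-< : ∀ e x y → y < x → mem y (e ++ [ x ]) ≡ mem y e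
  mem-snoc-< e x y y<x =
    P.trans (mem-snoc y e x) (P.trans (cong (mem y e ∨_) (<⇒≡ᵇ-false y<x)) (BP.∨-identityʳ _))

  fresh : ℕ → List ℕ → List ℕ
  fresh x e = if mem x e then [] else [ x ]

  deduplicate-snoc : ∀ e x → deduplicate ℕP._≟_ (e ++ [ x ]) ≡ deduplicate ℕP._≟_ e ++ fresh x e
  deduplicate-snoc []      x = refl
  deduplicate-snoc (y ∷ e) x = cong (y ∷_) (begin
    filter ≢y (deduplicate ℕP._≟_ (e ++ [ x ]))            ≡⟨ cong (filter ≢y) (deduplicate-snoc e x) ⟩
    filter ≢y (deduplicate ℕP._≟_ e ++ fresh x e)          ≡⟨ LP.filter-++ ≢y (deduplicate ℕP._≟_ e) (fresh x e) ⟩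
    filter ≢y (deduplicate ℕP._≟_ e) ++ filter ≢y (fresh x e)
      ≡⟨ cong (filter ≢y (deduplicate ℕP._≟_ e) ++_) filter-fresh ⟩
    filter ≢y (deduplicate ℕP._≟_ e) ++ fresh x (y ∷ e)    ∎)
    where
    open P.≡-Reasoning
    ≢y = ¬? ∘ (y ℕP.≟_)
    filter-fresh : filter ≢y (fresh x e) ≡ fresh x (y ∷ e)
    filter-fresh with mem x e
    ... | true  rewrite BP.∨-zeroʳ (x ≡ᵇ y) = refl
    ... | false rewrite BP.∨-identityʳ (x ≡ᵇ y) | ≡ᵇ-sym x y with y ≡ᵇ x
    ...   | true  = refl
    ...   | false = refl

  dist-snoc : ∀ e x → dist (e ++ [ x ]) ≡ (if mem x e then dist e else suc (dist e))
  dist-snoc e x rewrite deduplicate-snoc e x | LP.length-++ (deduplicate ℕP._≟_ e) {fresh x e} with mem x e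
  ... | true  = ℕP.+-identityʳ _
  ... | false = ℕP.+-comm _ 1

  dist-snoc-pos : ∀ e x → ∃ λ d → dist (e ++ [ x ]) ≡ suc d
  dist-snoc-pos []      x = _ , refl
  dist-snoc-pos (y ∷ e) x = _ , refl

  endPattern : List ℕ → ℕ → Bool
  endPattern (a ∷ b ∷ [])    x = (b <ᵇ a) ∧ (b ≤ᵇ x)
  endPattern (a ∷ b ∷ c ∷ r) x = endPattern (b ∷ c ∷ r) x
  endPattern _               x = false

  hasPattern-snoc : ∀ e x → hasPattern (e ++ [ x ]) ≡ hasPattern e ∨ endPattern e x
  hasPattern-snoc []              x = refl
  hasPattern-snoc (a ∷ [])        x = refl
  hasPattern-snoc (a ∷ b ∷ [])    x = BP.∨-identityʳ _
  hasPattern-snoc (a ∷ b ∷ c ∷ r) x =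
    P.trans (cong (((b <ᵇ a) ∧ (b ≤ᵇ c)) ∨_) (hasPattern-snoc (b ∷ c ∷ r) x))
            (P.sym (BP.∨-assoc ((b <ᵇ a) ∧ (b ≤ᵇ c)) _ _))

  endPattern-snoc₂ : ∀ e a b x → endPattern ((e ++ [ a ]) ++ [ b ]) x ≡ (b <ᵇ a) ∧ (b ≤ᵇ x)
  endPattern-snoc₂ []              a b x = refl
  endPattern-snoc₂ (c ∷ [])        a b x = refl
  endPattern-snoc₂ (c ∷ d ∷ [])    a b x = refl
  endPattern-snoc₂ (c ∷ d ∷ f ∷ e) a b x = endPattern-snoc₂ (d ∷ f ∷ e) a b x

  winc : List ℕ → Bool
  winc (a ∷ b ∷ r) = (a ≤ᵇ b) ∧ winc (b ∷ r)
  winc _           = true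

  winc-snoc : ∀ e p x → winc ((e ++ [ p ]) ++ [ x ]) ≡ winc (e ++ [ p ]) ∧ (p ≤ᵇ x)
  winc-snoc []          p x = BP.∧-identityʳ _
  winc-snoc (c ∷ [])    p x =
    P.trans (cong ((c ≤ᵇ p) ∧_) (BP.∧-identityʳ _)) (cong (_∧ (p ≤ᵇ x)) (P.sym (BP.∧-identityʳ _)))
  winc-snoc (c ∷ d ∷ e) p x = P.trans (cong ((c ≤ᵇ d) ∧_) (winc-snoc (d ∷ e) p x)) (P.sym (BP.∧-assoc (c ≤ᵇ d) _ _))

  winc-extend : ∀ e p x → winc (e ++ [ p ]) ≡ true → winc ((e ++ [ p ]) ++ [ x ]) ≡ (p ≤ᵇ x)
  winc-extend e p x w = P.trans (winc-snoc e p x) (cong (_∧ (p ≤ᵇ x)) w)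

  winc-tail : ∀ c e → winc (c ∷ e) ≡ true → winc e ≡ true
  winc-tail c []      w = refl
  winc-tail c (d ∷ e) w = BP.∧-conicalʳ (c ≤ᵇ d) (winc (d ∷ e)) w

  winc⇒noPattern : ∀ e → winc e ≡ true → hasPattern e ≡ false
  winc⇒noPattern []              w = refl
  winc⇒noPattern (a ∷ [])        w = refl
  winc⇒noPattern (a ∷ b ∷ [])    w = refl
  winc⇒noPattern (a ∷ b ∷ c ∷ r) w =
    cong₂ (λ u v → (u ∧ (b ≤ᵇ c)) ∨ v) (<ᵇ-false (≤ᵇ-sound a b (BP.∧-conicalˡ (a ≤ᵇ b) _ w)))
          (winc⇒noPattern (b ∷ c ∷ r) (winc-tail a (b ∷ c ∷ r) w))

  winc⇒noEndPattern : ∀ e x → winc e ≡ true → endPattern e x ≡ false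
  winc⇒noEndPattern []              x w = refl
  winc⇒noEndPattern (a ∷ [])        x w = refl
  winc⇒noEndPattern (a ∷ b ∷ [])    x w rewrite <ᵇ-false (≤ᵇ-sound a b (BP.∧-conicalˡ (a ≤ᵇ b) _ w)) = refl
  winc⇒noEndPattern (a ∷ b ∷ c ∷ r) x w = winc⇒noEndPattern (b ∷ c ∷ r) x (winc-tail a (b ∷ c ∷ r) w)

  winc⇒noPattern-snoc : ∀ e x → winc e ≡ true → hasPattern (e ++ [ x ]) ≡ false
  winc⇒noPattern-snoc e x w =
    P.trans (hasPattern-snoc e x) (cong₂ _∨_ (winc⇒noPattern e w) (winc⇒noEndPattern e x w))

  mem-last : ∀ e p → mem p (e ++ [ p ]) ≡ true
  mem-last e p = P.trans (mem-snoc p e p) (P.trans (cong (mem p e ∨_) (≡ᵇ-refl p)) (BP.∨-zeroʳ _))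

  head≤last : ∀ c e p → winc (c ∷ (e ++ [ p ])) ≡ true → c ≤ p
  head≤last c []      p w = ≤ᵇ-sound c p (BP.∧-conicalˡ (c ≤ᵇ p) _ w)
  head≤last c (d ∷ e) p w =
    ℕP.≤-trans (≤ᵇ-sound c d (BP.∧-conicalˡ (c ≤ᵇ d) _ w)) (head≤last d e p (winc-tail c (d ∷ e ++ [ p ]) w))

  mem-above : ∀ e p y → winc (e ++ [ p ]) ≡ true → p < y → mem y (e ++ [ p ]) ≡ false
  mem-above []      p y w p<y rewrite >⇒≡ᵇ-false p<y = refl
  mem-above (c ∷ e) p y w p<y rewrite >⇒≡ᵇ-false (ℕP.≤-<-trans (head≤last c e p w) p<y) =
    mem-above e p y (winc-tail c (e ++ [ p ]) w) p<y

module Completions where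
  open P using (refl)
  open Bivariate
  open Sequences
  open S2 using (Σ; Σ-cong; Σ-cong′; Σ-zeroes; Σ-+; Σ-*ˡ; Σ-split-at; Σ-first; ΣL; ΣL-cong; ΣL-+; ΣI-suc;
                 when; when-true; when-false)
  open import Relation.Binary.Reasoning.Setoid Q.setoid

  tPow : ℕ → Q.Carrier
  tPow zero    = 1#
  tPow (suc d) = tPow d ⊠ T₁

  newWeight : List ℕ → ℕ → Q.Carrier
  newWeight e x = if mem x e then 1# else T₁

  tPow-snoc : ∀ e x → tPow (dist (e ++ [ x ])) ≈₁ tPow (dist e) ⊠ newWeight e x
  tPow-snoc e x rewrite dist-snoc e x with mem x e
  ... | true  = Q.sym (Q.*-identityʳ _)
  ... | false = Q.refl

  -- completions m e L = Σ t^dist over the pattern-avoiding sequences obtained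
  -- from e (of length m) by appending L entries, the i-th of them below m + i;
  -- for e = [] and m = 0 these are the sequences of A_L
  completions : ℕ → List ℕ → ℕ → Q.Carrier
  completions m e zero    = if hasPattern e then 0# else tPow (dist e)
  completions m e (suc L) = Σ (suc m) (λ x → completions (suc m) (e ++ [ x ]) L)

  -- decTails e y L = Σ over the strictly decreasing tails of L values below y,
  -- each value weighted by whether it is new for e
  decTails : List ℕ → ℕ → ℕ → Q.Carrier
  decTails e y zero    = 1#
  decTails e y (suc L) = Σ y (λ x → newWeight e x ⊠ decTails e x L)

  completions-pattern : ∀ L m e → hasPattern e ≡ true → completions m e L ≈₁ 0#
  completions-pattern zero    m e h rewrite h = Q.refl
  completions-pattern (suc L) m e h = Σ-zeroes (suc m) (λ x _ →
    completions-pattern L (suc m) (e ++ [ x ]) (P.trans (hasPattern-snoc e x) (cong (_∨ endPattern e x) h)))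

  decTails-cong : ∀ L y e e′ → (∀ x → x < y → mem x e ≡ mem x e′) → decTails e y L ≈₁ decTails e′ y L
  decTails-cong zero    y e e′ h = Q.refl
  decTails-cong (suc L) y e e′ h = Σ-cong y (λ x x<y →
    Q.*-cong (weight x x<y) (decTails-cong L x e e′ (λ x′ x′<x → h x′ (ℕP.<-trans x′<x x<y))))
    where
    weight : ∀ x → x < y → newWeight e x ≈₁ newWeight e′ x
    weight x x<y rewrite h x x<y = Q.refl

  decTails-snoc : ∀ L e x → decTails (e ++ [ x ]) x L ≈₁ decTails e x L
  decTails-snoc L e x = decTails-cong L x (e ++ [ x ]) e (mem-snoc-< e x)

  pattern-after-descent : ∀ e w y x → y < w → hasPattern ((e ++ [ w ]) ++ [ y ]) ≡ false →
    hasPattern (((e ++ [ w ]) ++ [ y ]) ++ [ x ]) ≡ (y ≤ᵇ x)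
  pattern-after-descent e w y x y<w h = P.trans (hasPattern-snoc ((e ++ [ w ]) ++ [ y ]) x)
    (cong₂ _∨_ h (P.trans (endPattern-snoc₂ e w y x) (cong (_∧ (y ≤ᵇ x)) (<ᵇ-true y<w))))

  mutual
    -- once the sequence has descended it must keep decreasing strictly
    completions-descent : ∀ L m e w y → y < w → y ≤ m → hasPattern ((e ++ [ w ]) ++ [ y ]) ≡ false →
      completions m ((e ++ [ w ]) ++ [ y ]) L
        ≈₁ tPow (dist ((e ++ [ w ]) ++ [ y ])) ⊠ decTails ((e ++ [ w ]) ++ [ y ]) y L
    completions-descent zero    m e w y y<w y≤m h rewrite h = Q.sym (Q.*-identityʳ _)
    completions-descent (suc L) m e w y y<w y≤m h = begin
      Σ (suc m) (λ x → completions (suc m) (e′ ++ [ x ]) L)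
        ≈⟨ Σ-split-at y (suc m) _ (ℕP.m≤n⇒m≤1+n y≤m) ⟩
      Σ y (λ x → completions (suc m) (e′ ++ [ x ]) L)
        ⊞ Σ (suc m ∸ y) (λ s → completions (suc m) (e′ ++ [ y ℕ.+ s ]) L)
        ≈⟨ Q.+-cong (descents L m (e ++ [ w ]) y y≤m below) (Σ-zeroes (suc m ∸ y) (λ s _ → above s)) ⟩
      tPow (dist e′) ⊠ decTails e′ y (suc L) ⊞ 0#
        ≈⟨ Q.+-identityʳ _ ⟩
      tPow (dist e′) ⊠ decTails e′ y (suc L) ∎
      where
      e′ = (e ++ [ w ]) ++ [ y ]
      below : ∀ x → x < y → hasPattern (e′ ++ [ x ]) ≡ false
      below x x<y = P.trans (pattern-after-descent e w y x y<w h) (≤ᵇ-false x<y)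
      above : ∀ s → completions (suc m) (e′ ++ [ y ℕ.+ s ]) L ≈₁ 0#
      above s = completions-pattern L (suc m) (e′ ++ [ y ℕ.+ s ])
        (P.trans (pattern-after-descent e w y (y ℕ.+ s) y<w h) (≤ᵇ-true (ℕP.m≤m+n y s)))

    descents : ∀ L m e p → p ≤ m → (∀ x → x < p → hasPattern ((e ++ [ p ]) ++ [ x ]) ≡ false) →
      Σ p (λ x → completions (suc m) ((e ++ [ p ]) ++ [ x ]) L)
        ≈₁ tPow (dist (e ++ [ p ])) ⊠ decTails (e ++ [ p ]) p (suc L)
    descents L m e p p≤m h =
      Q.trans (Σ-cong p step) (Q.sym (Σ-*ˡ p (tPow (dist e′)) (λ x → newWeight e′ x ⊠ decTails e′ x L)))
      where
      e′ = e ++ [ p ]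
      step : ∀ x → x < p → completions (suc m) (e′ ++ [ x ]) L ≈₁ tPow (dist e′) ⊠ (newWeight e′ x ⊠ decTails e′ x L)
      step x x<p = begin
        completions (suc m) (e′ ++ [ x ]) L
          ≈⟨ completions-descent L (suc m) e p x x<p (ℕP.≤-trans (ℕP.<⇒≤ x<p) (ℕP.m≤n⇒m≤1+n p≤m)) (h x x<p) ⟩
        tPow (dist (e′ ++ [ x ])) ⊠ decTails (e′ ++ [ x ]) x L
          ≈⟨ Q.*-cong (tPow-snoc e′ x) (decTails-snoc L e′ x) ⟩
        (tPow (dist e′) ⊠ newWeight e′ x) ⊠ decTails e′ x L
          ≈⟨ Q.*-assoc _ _ _ ⟩
        tPow (dist e′) ⊠ (newWeight e′ x ⊠ decTails e′ x L) ∎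

  ascents : ℕ → List ℕ → ℕ → ℕ → Q.Carrier
  ascents m e p zero    = 0#
  ascents m e p (suc L) = Σ (suc m ∸ p) (λ s → completions (suc m) (e ++ [ p ℕ.+ s ]) L)

  -- a completion of a weakly increasing e ++ [ p ] either descends at once
  -- (and is then a strictly decreasing tail) or continues with a value ≥ p
  completions-winc : ∀ L m e p → winc (e ++ [ p ]) ≡ true → p ≤ m →
    completions m (e ++ [ p ]) L
      ≈₁ tPow (dist (e ++ [ p ])) ⊠ decTails (e ++ [ p ]) p L ⊞ ascents m (e ++ [ p ]) p L
  completions-winc zero    m e p w p≤m rewrite winc⇒noPattern (e ++ [ p ]) w =
    Q.sym (Q.trans (Q.+-identityʳ _) (Q.*-identityʳ _))
  completions-winc (suc L) m e p w p≤m =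
    Q.trans (Σ-split-at p (suc m) _ (ℕP.m≤n⇒m≤1+n p≤m))
            (Q.+-cong (descents L m e p p≤m (λ x _ → winc⇒noPattern-snoc (e ++ [ p ]) x w)) Q.refl)

  ascents-winc : ∀ L m e p → winc (e ++ [ p ]) ≡ true → p ≤ suc m →
    Σ (suc m) (λ y → when (winc ((e ++ [ p ]) ++ [ y ])) (completions (suc m) ((e ++ [ p ]) ++ [ y ]) L))
      ≈₁ ascents m (e ++ [ p ]) p (suc L)
  ascents-winc L m e p w p≤1+m = begin
    Σ (suc m) f
      ≈⟨ Σ-split-at p (suc m) f p≤1+m ⟩
    Σ p f ⊞ Σ (suc m ∸ p) (λ s → f (p ℕ.+ s))
      ≈⟨ Q.+-cong (Σ-zeroes p (λ y y<p → when-false _ (P.trans (winc-extend e p y w) (≤ᵇ-false y<p))))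
                  (Σ-cong′ (suc m ∸ p) (λ s → when-true _
                     (P.trans (winc-extend e p (p ℕ.+ s) w) (≤ᵇ-true (ℕP.m≤m+n p s))))) ⟩
    0# ⊞ ascents m (e ++ [ p ]) p (suc L)
      ≈⟨ Q.+-identityˡ _ ⟩
    ascents m (e ++ [ p ]) p (suc L) ∎
    where
    f : ℕ → Q.Carrier
    f y = when (winc ((e ++ [ p ]) ++ [ y ])) (completions (suc m) ((e ++ [ p ]) ++ [ y ]) L)

  wincCompletions : ℕ → ℕ → Q.Carrier
  wincCompletions l L =
    ΣL (I l) (λ e → Σ (suc l) (λ x → when (winc (e ++ [ x ])) (completions (suc l) (e ++ [ x ]) L)))

  wincTails : ℕ → ℕ → Q.Carrier
  wincTails l L =
    ΣL (I l) (λ e → Σ (suc l) (λ x → when (winc (e ++ [ x ])) (tPow (dist (e ++ [ x ])) ⊠ decTails (e ++ [ x ]) x L)))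

  wincCompletions-0 : ∀ l → wincCompletions l 0 ≈₁ wincTails l 0
  wincCompletions-0 l = ΣL-cong (I l) (λ e → Σ-cong′ (suc l) (λ x → end e x))
    where
    end : ∀ e x → when (winc (e ++ [ x ])) (completions (suc l) (e ++ [ x ]) 0)
                    ≈₁ when (winc (e ++ [ x ])) (tPow (dist (e ++ [ x ])) ⊠ 1#)
    end e x with winc (e ++ [ x ]) in w
    ... | false = Q.refl
    ... | true rewrite winc⇒noPattern (e ++ [ x ]) w = Q.sym (Q.*-identityʳ _)

  wincCompletions-suc : ∀ l L → wincCompletions l (suc L) ≈₁ wincTails l (suc L) ⊞ wincCompletions (suc l) L
  wincCompletions-suc l L = begin
    wincCompletions l (suc L)
      ≈⟨ ΣL-cong (I l) (λ e → Σ-cong (suc l) (split e)) ⟩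
    ΣL (I l) (λ e → Σ (suc l) (λ x → tail e x ⊞ longer (e ++ [ x ])))
      ≈⟨ ΣL-cong (I l) (λ e → Σ-+ (suc l) (tail e) (λ x → longer (e ++ [ x ]))) ⟩
    ΣL (I l) (λ e → Σ (suc l) (tail e) ⊞ Σ (suc l) (λ x → longer (e ++ [ x ])))
      ≈⟨ ΣL-+ (I l) _ _ ⟩
    wincTails l (suc L) ⊞ ΣL (I l) (λ e → Σ (suc l) (λ x → longer (e ++ [ x ])))
      ≈⟨ Q.+-cong Q.refl (Q.sym (ΣI-suc l longer)) ⟩
    wincTails l (suc L) ⊞ wincCompletions (suc l) L ∎
    where
    tail : List ℕ → ℕ → Q.Carrier
    tail e x = when (winc (e ++ [ x ])) (tPow (dist (e ++ [ x ])) ⊠ decTails (e ++ [ x ]) x (suc L))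
    longer : List ℕ → Q.Carrier
    longer e = Σ (suc (suc l)) (λ y → when (winc (e ++ [ y ])) (completions (suc (suc l)) (e ++ [ y ]) L))
    split : ∀ e x → x < suc l →
      when (winc (e ++ [ x ])) (completions (suc l) (e ++ [ x ]) (suc L)) ≈₁ tail e x ⊞ longer (e ++ [ x ])
    split e x x<1+l with winc (e ++ [ x ]) in w
    ... | false = Q.sym (Q.trans (Q.+-identityˡ _) (Σ-zeroes (suc (suc l)) (λ y _ →
                    when-false _ (P.trans (winc-snoc e x y) (cong (_∧ (x ≤ᵇ y)) w)))))
    ... | true = Q.trans (completions-winc (suc L) (suc l) e x w x≤1+l)
                         (Q.+-cong Q.refl (Q.sym (ascents-winc L (suc l) e x w (ℕP.m≤n⇒m≤1+n x≤1+l))))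
      where
      x≤1+l : x ≤ suc l
      x≤1+l = ℕP.m≤n⇒m≤1+n (ℕP.≤-pred x<1+l)

  wincCompletions-unroll : ∀ L l → wincCompletions l L ≈₁ Σ (suc L) (λ j → wincTails (l ℕ.+ j) (L ∸ j))
  wincCompletions-unroll zero    l rewrite ℕP.+-identityʳ l =
    Q.trans (wincCompletions-0 l) (Q.sym (Q.+-identityˡ _))
  wincCompletions-unroll (suc L) l = begin
    wincCompletions l (suc L)
      ≈⟨ wincCompletions-suc l L ⟩
    wincTails l (suc L) ⊞ wincCompletions (suc l) L
      ≈⟨ Q.+-cong (Q.reflexive (cong (λ k → wincTails k (suc L)) (P.sym (ℕP.+-identityʳ l))))
                  (wincCompletions-unroll L (suc l)) ⟩
    wincTails (l ℕ.+ 0) (suc L) ⊞ Σ (suc L) (λ j → wincTails (suc l ℕ.+ j) (L ∸ j))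
      ≈⟨ Q.+-cong Q.refl (Σ-cong′ (suc L) (λ j →
           Q.reflexive (cong (λ k → wincTails k (L ∸ j)) (P.sym (ℕP.+-suc l j))))) ⟩
    wincTails (l ℕ.+ 0) (suc L) ⊞ Σ (suc L) (λ j → wincTails (l ℕ.+ suc j) (suc L ∸ suc j))
      ≈⟨ Q.sym (Σ-first (suc L) _) ⟩
    Σ (suc (suc L)) (λ j → wincTails (l ℕ.+ j) (suc L ∸ j)) ∎

  completions-I : ∀ n m → ΣL (I m) (λ e → completions m e n) ≈₁ ΣL (I (m ℕ.+ n)) (λ e → completions (m ℕ.+ n) e 0)
  completions-I zero    m rewrite ℕP.+-identityʳ m = Q.refl
  completions-I (suc n) m rewrite ℕP.+-suc m n =
    Q.trans (Q.sym (ΣI-suc m (λ e → completions (suc m) e n))) (completions-I n (suc m))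

module PrefixSeries where
  open P using (refl)
  open Bivariate
  open Coefficients
  open Sequences
  open Completions
  open S2 using (when)
  open SΣ using () renaming (when to whenₛ)
  open import Relation.Binary.Reasoning.Setoid Q.setoid

  -- tailSeries e y = ∏_{x<y} (1 + z · newWeight e x): its coefficient of z^L
  -- counts the strictly decreasing tails of length L below y
  tailSeries : List ℕ → ℕ → Ser
  tailSeries e zero    = 1ₛ
  tailSeries e (suc y) = tailSeries e y ⊛′ (1ₛ ⊕′ Z ⊛′ S2.constant (newWeight e y))

  tailSeries-coeff : ∀ e y L → tailSeries e y L ≈₁ decTails e y L
  tailSeries-coeff e zero    zero    = Q.refl
  tailSeries-coeff e zero    (suc L) = Q.refl
  tailSeries-coeff e (suc y) L =
    Q.trans (expand L) (Q.trans (coeff-+ (tailSeries e y) _ L) (step L))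
    where
    w = S2.constant (newWeight e y)
    expand : tailSeries e (suc y) ≋ tailSeries e y ⊕′ Z ⊛′ (w ⊛′ tailSeries e y)
    expand = R.trans (R.*-cong R.refl (R.+-cong 1≋const R.refl))
      (solve 3 (λ a z b → a :* (con (+ 1) :+ z :* b) := a :+ z :* (b :* a)) R.refl (tailSeries e y) Z w)
    step : ∀ L → tailSeries e y L ⊞ (Z ⊛′ (w ⊛′ tailSeries e y)) L ≈₁ decTails e (suc y) L
    step zero    = Q.trans (Q.+-cong (tailSeries-coeff e y 0) (coeff-z*-0 _)) (Q.+-identityʳ _)
    step (suc L) = Q.+-cong (tailSeries-coeff e y (suc L))
      (Q.trans (coeff-z*-suc _ L) (Q.trans (coeff-constant* _ _ L) (Q.*-cong Q.refl (tailSeries-coeff e y L))))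

  -- prefixWeight l e x = z^l t^(dist e - 1) · tailSeries e x, for a prefix e of
  -- length l with last entry x (the factor t of the first entry is split off)
  prefixWeight : ℕ → List ℕ → ℕ → Ser
  prefixWeight l e x = z^ l ⊛′ (S2.constant (tPow (dist e ∸ 1)) ⊛′ tailSeries e x)

  prefixSeries : ℕ → Ser
  prefixSeries j =
    SΣ.ΣL (I j) (λ e → SΣ.Σ (suc j) (λ x → whenₛ (winc (e ++ [ x ])) (prefixWeight (suc j) (e ++ [ x ]) x)))

  tPow-pred : ∀ e x → T₁ ⊠ tPow (dist (e ++ [ x ]) ∸ 1) ≈₁ tPow (dist (e ++ [ x ]))
  tPow-pred e x with dist-snoc-pos e x
  ... | d , eq rewrite eq = Q.*-comm _ _

  prefixWeight-coeff : ∀ j e x L →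
    tPow (dist (e ++ [ x ])) ⊠ decTails (e ++ [ x ]) x L ≈₁ (T₂ ⊛′ prefixWeight (suc j) (e ++ [ x ]) x) (suc j ℕ.+ L)
  prefixWeight-coeff j e x L = Q.sym (begin
    (T₂ ⊛′ prefixWeight (suc j) e′ x) (suc j ℕ.+ L)            ≈⟨ coeff-constant* T₁ _ (suc j ℕ.+ L) ⟩
    T₁ ⊠ prefixWeight (suc j) e′ x (suc j ℕ.+ L)               ≈⟨ Q.*-cong Q.refl (z^-shift (suc j) _ L) ⟩
    T₁ ⊠ (S2.constant (tPow (dist e′ ∸ 1)) ⊛′ tailSeries e′ x) L ≈⟨ Q.*-cong Q.refl (coeff-constant* _ _ L) ⟩
    T₁ ⊠ (tPow (dist e′ ∸ 1) ⊠ tailSeries e′ x L)              ≈⟨ Q.sym (Q.*-assoc _ _ _) ⟩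
    (T₁ ⊠ tPow (dist e′ ∸ 1)) ⊠ tailSeries e′ x L              ≈⟨ Q.*-cong (tPow-pred e x) (tailSeries-coeff e′ x L) ⟩
    tPow (dist e′) ⊠ decTails e′ x L                            ∎)
    where
    e′ = e ++ [ x ]

  wincTails-coeff : ∀ j L → wincTails j L ≈₁ T₁ ⊠ prefixSeries j (suc j ℕ.+ L)
  wincTails-coeff j L = Q.sym (begin
    T₁ ⊠ prefixSeries j (suc j ℕ.+ L)
      ≈⟨ Q.*-cong Q.refl (Q.trans (coeff-ΣL (I j) _ (suc j ℕ.+ L)) (S2.ΣL-cong (I j) (λ e → coeff-Σ (suc j) _ _))) ⟩
    T₁ ⊠ S2.ΣL (I j) (λ e → S2.Σ (suc j) (λ x → term e x))
      ≈⟨ S2.ΣL-*ˡ (I j) T₁ _ ⟩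
    S2.ΣL (I j) (λ e → T₁ ⊠ S2.Σ (suc j) (λ x → term e x))
      ≈⟨ S2.ΣL-cong (I j) (λ e → Q.trans (S2.Σ-*ˡ (suc j) T₁ _) (S2.Σ-cong′ (suc j) (λ x → one e x))) ⟩
    wincTails j L ∎)
    where
    term : List ℕ → ℕ → Q.Carrier
    term e x = whenₛ (winc (e ++ [ x ])) (prefixWeight (suc j) (e ++ [ x ]) x) (suc j ℕ.+ L)
    one : ∀ e x → T₁ ⊠ term e x ≈₁ when (winc (e ++ [ x ])) (tPow (dist (e ++ [ x ])) ⊠ decTails (e ++ [ x ]) x L)
    one e x with winc (e ++ [ x ])
    ... | false = Q.zeroʳ _
    ... | true  = Q.trans (Q.sym (coeff-constant* T₁ _ (suc j ℕ.+ L))) (Q.sym (prefixWeight-coeff j e x L))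

  tPow-coeff : ∀ d k → tPow d k ≡ (if d ≡ᵇ k then + 1 else + 0)
  tPow-coeff zero    zero    = refl
  tPow-coeff zero    (suc k) = refl
  tPow-coeff (suc d) zero    = P.trans (Q.*-comm (tPow d) T₁ zero) (S1.conv-var-0 (tPow d))
  tPow-coeff (suc d) (suc k) = P.trans (Q.*-comm (tPow d) T₁ (suc k)) (P.trans (S1.conv-var-suc (tPow d) k) (tPow-coeff d k))

  count : ∀ L k → + length (filterᵇ (λ e → dist e ≡ᵇ k) (filterᵇ (λ e → not (hasPattern e)) L))
                  ≡ S2.ΣL L (λ e → completions 0 e 0) k
  count []      k = refl
  count (e ∷ L) k rewrite S1.⊹-eq (completions 0 e 0) (S2.ΣL L (λ e → completions 0 e 0)) k with hasPattern e
  ... | true = P.trans (count L k) (P.sym (ℤP.+-identityˡ _))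
  ... | false rewrite tPow-coeff (dist e) k with dist e ≡ᵇ k
  ...   | true  = cong (+ 1 +ℤ_) (count L k)
  ...   | false = P.trans (count L k) (P.sym (ℤP.+-identityˡ _))

  F-completions : ∀ n → F n ≈₁ completions 0 [] n
  F-completions n k = P.trans (count (I n) k)
    (P.sym (P.trans (P.sym (P.trans (S1.⊹-eq (completions 0 [] n) 0# k) (ℤP.+-identityʳ _))) (completions-I n 0 k)))

  F-prefixes : F ≋ 1ₛ ⊕′ T₂ ⊛′ Σ∞ prefixSeries
  F-prefixes zero = Q.trans (F-completions 0)
    (Q.sym (Q.trans (coeff-+ 1ₛ _ 0) (Q.trans (Q.+-cong Q.refl (Q.trans (coeff-constant* T₁ _ 0) (Q.zeroʳ T₁)))
                                               (Q.+-identityʳ _))))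
  F-prefixes (suc L) = begin
    F (suc L)                                               ≈⟨ F-completions (suc L) ⟩
    completions 0 [] (suc L)                                ≈⟨ Q.sym (Q.+-identityʳ _) ⟩
    wincCompletions 0 L                                     ≈⟨ wincCompletions-unroll L 0 ⟩
    S2.Σ (suc L) (λ j → wincTails j (L ∸ j))
      ≈⟨ S2.Σ-cong (suc L) (λ j j<1+L → Q.trans (wincTails-coeff j (L ∸ j))
                                          (Q.*-cong Q.refl (Q.reflexive (cong (prefixSeries j) (length≡ j j<1+L))))) ⟩
    S2.Σ (suc L) (λ j → T₁ ⊠ prefixSeries j (suc L))         ≈⟨ Q.sym (S2.Σ-*ˡ (suc L) T₁ _) ⟩
    T₁ ⊠ Σ∞ prefixSeries (suc L)                            ≈⟨ Q.sym (coeff-constant* T₁ _ (suc L)) ⟩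
    (T₂ ⊛′ Σ∞ prefixSeries) (suc L)                         ≈⟨ Q.sym (Q.+-identityˡ _) ⟩
    1ₛ (suc L) ⊞ (T₂ ⊛′ Σ∞ prefixSeries) (suc L)            ≈⟨ Q.sym (coeff-+ 1ₛ _ (suc L)) ⟩
    (1ₛ ⊕′ T₂ ⊛′ Σ∞ prefixSeries) (suc L)                   ∎
    where
    length≡ : ∀ j → j < suc L → suc j ℕ.+ (L ∸ j) ≡ suc L
    length≡ j (s≤s j≤L) = cong suc (ℕP.m+[n∸m]≡n j≤L)

-- If the prefix ends
-- in x and the new entry is x + s, the weight gains a factor z · jump s:
-- a repeated value (s = 0) changes nothing else, a new value gives a
-- factor t and enlarges the set of possible tail values.

module PrefixExtension where
  open P using (refl)
  open Bivariate
  open Coefficients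
  open Sequences
  open Completions
  open PrefixSeries

  -- the factors of a new last value: α for last + 1, β for each further step
  α : Ser
  α = T₂ ⊛′ (1ₛ ⊕′ Z)

  β : Ser
  β = 1ₛ ⊕′ Z ⊛′ T₂

  jump : ℕ → Ser
  jump zero          = 1ₛ
  jump (suc zero)    = α
  jump (suc (suc s)) = β ⊛′ jump (suc s)

  tailGrowth : ℕ → Ser
  tailGrowth zero    = 1ₛ
  tailGrowth (suc s) = tailGrowth s ⊛′ (1ₛ ⊕′ Z ⊛′ S2.constant (if s ≡ᵇ 0 then 1# else T₁))

  tailSeries-cong : ∀ y e e′ → (∀ x → x < y → mem x e ≡ mem x e′) → tailSeries e y ≋ tailSeries e′ y
  tailSeries-cong zero    e e′ h = R.refl
  tailSeries-cong (suc y) e e′ h =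
    R.*-cong (tailSeries-cong y e e′ (λ x x<y → h x (ℕP.m<n⇒m<1+n x<y))) (R.+-cong R.refl (R.*-cong R.refl weight))
    where
    weight : S2.constant (newWeight e y) ≋ S2.constant (newWeight e′ y)
    weight rewrite h y (ℕP.n<1+n y) = R.refl

  tailSeries-snoc : ∀ e x → tailSeries (e ++ [ x ]) x ≋ tailSeries e x
  tailSeries-snoc e x = tailSeries-cong x (e ++ [ x ]) e (mem-snoc-< e x)

  -- above the last entry x of a weakly increasing prefix only x itself occurs
  newWeight-above : ∀ e x s → winc (e ++ [ x ]) ≡ true →
    newWeight (e ++ [ x ]) (x ℕ.+ s) ≡ (if s ≡ᵇ 0 then 1# else T₁)
  newWeight-above e x zero    w rewrite ℕP.+-identityʳ x | mem-last e x = refl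
  newWeight-above e x (suc s) w rewrite mem-above e x (x ℕ.+ suc s) w (ℕP.m<m+n x (s≤s z≤n)) = refl

  tailSeries-above : ∀ e x s → winc (e ++ [ x ]) ≡ true →
    tailSeries (e ++ [ x ]) (x ℕ.+ s) ≋ tailSeries (e ++ [ x ]) x ⊛′ tailGrowth s
  tailSeries-above e x zero    w rewrite ℕP.+-identityʳ x = R.sym (R.*-identityʳ _)
  tailSeries-above e x (suc s) w rewrite ℕP.+-suc x s =
    R.trans (R.*-cong (tailSeries-above e x s w)
                      (R.+-cong R.refl (R.*-cong R.refl (R.reflexive (cong S2.constant (newWeight-above e x s w))))))
            (R.*-assoc _ _ _)

  jump-tailGrowth : ∀ s → jump (suc s) ≋ T₂ ⊛′ tailGrowth (suc s)
  jump-tailGrowth zero = R.*-cong R.refl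
    (R.trans (R.+-cong R.refl (R.sym (R.trans (R.*-cong R.refl S2.constant-1) (R.*-identityʳ Z)))) (R.sym (R.*-identityˡ _)))
  jump-tailGrowth (suc s) = R.trans (R.*-cong R.refl (jump-tailGrowth s))
    (solve 4 (λ t z g one → (one :+ z :* t) :* (t :* g) := t :* (g :* (one :+ z :* t))) R.refl T₂ Z (tailGrowth (suc s)) 1ₛ)

  prefixWeight-extend : ∀ j e x s → winc (e ++ [ x ]) ≡ true →
    prefixWeight (suc (suc j)) ((e ++ [ x ]) ++ [ x ℕ.+ s ]) (x ℕ.+ s) ≋ (Z ⊛′ prefixWeight (suc j) (e ++ [ x ]) x) ⊛′ jump s
  prefixWeight-extend j e x zero w
    rewrite ℕP.+-identityʳ x | dist-snoc (e ++ [ x ]) x | mem-last e x =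
    R.trans (R.*-cong R.refl (R.*-cong R.refl (tailSeries-snoc (e ++ [ x ]) x)))
            (R.trans (R.*-assoc Z (z^ (suc j)) _) (R.sym (R.*-identityʳ _)))
  prefixWeight-extend j e x (suc s) w
    rewrite dist-snoc (e ++ [ x ]) (x ℕ.+ suc s) | mem-above e x (x ℕ.+ suc s) w (ℕP.m<m+n x (s≤s z≤n))
    with dist-snoc-pos e x
  ... | d , eq rewrite eq =
    R.trans (R.*-cong R.refl (R.*-cong (S2.constant-* (tPow d) T₁)
                                       (R.trans (tailSeries-snoc (e ++ [ x ]) (x ℕ.+ suc s)) (tailSeries-above e x (suc s) w))))
    (R.trans (solve 6 (λ z zj c t p g → (z :* zj) :* ((c :* t) :* (p :* g)) := (z :* (zj :* (c :* p))) :* (t :* g))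
                      R.refl Z (z^ (suc j)) (S2.constant (tPow d)) T₂ (tailSeries (e ++ [ x ]) x) (tailGrowth (suc s)))
             (R.*-cong R.refl (R.sym (jump-tailGrowth s))))

-- The height of a weakly increasing prefix of
-- length l with last entry x is l - x ≥ 1.  Appending x + s (s ≤ height)
-- gives height h + 1 - s.  Grouping the prefixes by height gives series
-- heightSeries j h, and ascentSeries j h collects the prefixes followed by
-- one pending strict ascent that lands at height h.

module HeightRecursion where
  open P using (refl)
  open Bivariate
  open Coefficients
  open Sequences
  open PrefixSeries
  open PrefixExtension
  open SΣ using (when; when-false; when-cong; when-*ˡ; when-1)
  open import Relation.Binary.Reasoning.Setoid R.setoid

  overPrefixes : ℕ → (List ℕ → ℕ → Ser) → Ser
  overPrefixes j H = SΣ.ΣL (I j) (λ e → SΣ.Σ (suc j) (H e))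

  overPrefixes-cong : ∀ j H H′ → (∀ e x → x < suc j → H e x ≋ H′ e x) → overPrefixes j H ≋ overPrefixes j H′
  overPrefixes-cong j H H′ h = SΣ.ΣL-cong (I j) (λ e → SΣ.Σ-cong (suc j) (h e))

  overPrefixes-zeroes : ∀ j H → (∀ e x → x < suc j → H e x ≋ 0ₛ) → overPrefixes j H ≋ 0ₛ
  overPrefixes-zeroes j H h = SΣ.ΣL-zeroes (I j) (λ e → SΣ.Σ-zeroes (suc j) (h e))

  overPrefixes-linear : ∀ j c c′ A B →
    overPrefixes j (λ e x → c ⊛′ A e x ⊕′ c′ ⊛′ B e x) ≋ c ⊛′ overPrefixes j A ⊕′ c′ ⊛′ overPrefixes j B
  overPrefixes-linear j c c′ A B =
    R.trans (SΣ.ΣL-cong (I j) (λ e → R.trans (SΣ.Σ-+ (suc j) _ _)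
              (R.+-cong (R.sym (SΣ.Σ-*ˡ (suc j) c (A e))) (R.sym (SΣ.Σ-*ˡ (suc j) c′ (B e))))))
            (R.trans (SΣ.ΣL-+ (I j) _ _) (R.+-cong (R.sym (SΣ.ΣL-*ˡ (I j) c _)) (R.sym (SΣ.ΣL-*ˡ (I j) c′ _))))

  overPrefixes-coeff : ∀ j H m → overPrefixes j H m ≈₁ S2.ΣL (I j) (λ e → S2.Σ (suc j) (λ x → H e x m))
  overPrefixes-coeff j H m = Q.trans (coeff-ΣL (I j) _ m) (S2.ΣL-cong (I j) (λ e → coeff-Σ (suc j) (H e) m))

  overPrefixes-order : ∀ p j H → (∀ e x → HasOrder p (H e x)) → HasOrder p (overPrefixes j H)
  overPrefixes-order p j H h m m<p =
    Q.trans (overPrefixes-coeff j H m) (S2.ΣL-zeroes (I j) (λ e → S2.Σ-zeroes (suc j) (λ x _ → h e x m m<p)))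

  Σ-delta-rev : ∀ N h (f : ℕ → Ser) →
    SΣ.Σ N (λ s → when (h ≡ᵇ N ∸ s) (f s)) ≋ when ((1 ≤ᵇ h) ∧ (h ≤ᵇ N)) (f (N ∸ h))
  Σ-delta-rev N h f = R.trans (SΣ.Σ-rev N _)
    (R.trans (SΣ.Σ-cong N (λ i i<N → R.reflexive (cong (λ m → when (h ≡ᵇ m) (f (N ∸ suc i))) (ℕP.m∸[m∸n]≡n i<N))))
             (shifted h))
    where
    shifted : ∀ h → SΣ.Σ N (λ i → when (h ≡ᵇ suc i) (f (N ∸ suc i))) ≋ when ((1 ≤ᵇ h) ∧ (h ≤ᵇ N)) (f (N ∸ h))
    shifted zero      = SΣ.Σ-zeroes N (λ i _ → R.refl)
    shifted (suc h₀) =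
      R.trans (SΣ.Σ-cong′ N (λ i → R.reflexive (cong (λ b → when b (f (N ∸ suc i))) (≡ᵇ-sym h₀ i))))
              (SΣ.Σ-delta N h₀ (λ i → f (N ∸ suc i)))

  heightStep : ℕ → ℕ → Ser
  heightStep he h = when ((1 ≤ᵇ h) ∧ (h ≤ᵇ suc he)) (jump (suc he ∸ h))

  strictStep : ℕ → ℕ → Ser
  strictStep he h = when ((1 ≤ᵇ h) ∧ (h ≤ᵇ he)) (jump (suc he ∸ h))

  heightStep-split : ∀ he h₀ → heightStep he (suc h₀) ≋ when (h₀ ≡ᵇ he) 1ₛ ⊕′ strictStep he (suc h₀)
  heightStep-split he h₀ with ℕP.<-cmp h₀ he
  ... | tri< h₀<he _ _ rewrite <ᵇ-true (ℕP.m<n⇒m<1+n h₀<he) | <⇒≡ᵇ-false h₀<he | <ᵇ-true h₀<he =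
    R.sym (R.+-identityˡ _)
  ... | tri≈ _ refl _ rewrite <ᵇ-true (ℕP.n<1+n h₀) | ≡ᵇ-refl h₀ | <ᵇ-false (ℕP.≤-refl {h₀}) | ℕP.n∸n≡0 h₀ =
    R.sym (R.+-identityʳ _)
  ... | tri> _ _ he<h₀ rewrite <ᵇ-false {h₀} {suc he} he<h₀ | >⇒≡ᵇ-false he<h₀ | <ᵇ-false {h₀} {he} (ℕP.<⇒≤ he<h₀) =
    R.sym (R.+-identityʳ _)

  private
    ∸-suc : ∀ {a b} → suc b ≤ a → a ∸ b ≡ suc (a ∸ suc b)
    ∸-suc {suc a} (s≤s b≤a) = ℕP.+-∸-assoc 1 b≤a

  strictStep-split : ∀ he h₀ → strictStep he (suc h₀) ≋ α ⊛′ when (suc h₀ ≡ᵇ he) 1ₛ ⊕′ β ⊛′ strictStep he (suc (suc h₀))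
  strictStep-split he h₀ with ℕP.<-cmp (suc h₀) he
  ... | tri< 1+h₀<he _ _ rewrite <ᵇ-true (ℕP.<-trans (ℕP.n<1+n h₀) 1+h₀<he) | <⇒≡ᵇ-false 1+h₀<he | <ᵇ-true 1+h₀<he
                               | ∸-suc (ℕP.<⇒≤ 1+h₀<he) | ∸-suc 1+h₀<he =
    R.sym (R.trans (R.+-cong (R.zeroʳ α) R.refl) (R.+-identityˡ _))
  ... | tri≈ _ refl _ rewrite <ᵇ-true (ℕP.n<1+n h₀) | ≡ᵇ-refl h₀ | <ᵇ-false (ℕP.≤-refl {suc h₀}) | ℕP.m+n∸n≡m 1 h₀ =
    R.sym (R.trans (R.+-cong (R.*-identityʳ α) (R.zeroʳ β)) (R.+-identityʳ _))
  ... | tri> _ _ he<1+h₀ rewrite <ᵇ-false {h₀} {he} (ℕP.≤-pred he<1+h₀) | >⇒≡ᵇ-false he<1+h₀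
                               | <ᵇ-false {suc h₀} {he} (ℕP.<⇒≤ he<1+h₀) =
    R.sym (R.trans (R.+-cong (R.zeroʳ α) (R.zeroʳ β)) (R.+-identityʳ _))

  extend-prefix : ∀ j e x h → x < suc j →
    SΣ.Σ (suc (suc j)) (λ y → when (winc ((e ++ [ x ]) ++ [ y ]) ∧ (h ≡ᵇ suc (suc j) ∸ y))
                                    (prefixWeight (suc (suc j)) ((e ++ [ x ]) ++ [ y ]) y))
      ≋ when (winc (e ++ [ x ])) ((Z ⊛′ prefixWeight (suc j) (e ++ [ x ]) x) ⊛′ heightStep (suc j ∸ x) h)
  extend-prefix j e x h (s≤s x≤j) with winc (e ++ [ x ]) in w
  ... | false = SΣ.Σ-zeroes (suc (suc j)) (λ y _ → when-false _ (cong (_∧ _) (P.trans (winc-snoc e x y) (cong (_∧ _) w))))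
  ... | true = begin
    SΣ.Σ (suc (suc j)) f
      ≈⟨ SΣ.Σ-split-at x (suc (suc j)) f (ℕP.m≤n⇒m≤1+n x≤1+j) ⟩
    SΣ.Σ x f ⊕′ SΣ.Σ (suc (suc j) ∸ x) (λ s → f (x ℕ.+ s))
      ≈⟨ R.+-cong (SΣ.Σ-zeroes x (λ y y<x → when-false _ (cong (_∧ _) (P.trans (winc-extend e x y w) (≤ᵇ-false y<x)))))
                  (SΣ.Σ-cong′ (suc (suc j) ∸ x) ascend) ⟩
    0ₛ ⊕′ SΣ.Σ (suc (suc j) ∸ x) (λ s → when (h ≡ᵇ (suc (suc j) ∸ x) ∸ s) (C ⊛′ jump s))
      ≈⟨ R.+-identityˡ _ ⟩
    SΣ.Σ (suc (suc j) ∸ x) (λ s → when (h ≡ᵇ (suc (suc j) ∸ x) ∸ s) (C ⊛′ jump s))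
      ≡⟨ cong (λ N → SΣ.Σ N (λ s → when (h ≡ᵇ N ∸ s) (C ⊛′ jump s))) (ℕP.+-∸-assoc 1 x≤1+j) ⟩
    SΣ.Σ (suc he) (λ s → when (h ≡ᵇ suc he ∸ s) (C ⊛′ jump s))
      ≈⟨ Σ-delta-rev (suc he) h (λ s → C ⊛′ jump s) ⟩
    when ((1 ≤ᵇ h) ∧ (h ≤ᵇ suc he)) (C ⊛′ jump (suc he ∸ h))
      ≈⟨ when-*ˡ ((1 ≤ᵇ h) ∧ (h ≤ᵇ suc he)) C (jump (suc he ∸ h)) ⟩
    C ⊛′ heightStep he h ∎
    where
    x≤1+j : x ≤ suc j
    x≤1+j = ℕP.m≤n⇒m≤1+n x≤j
    he = suc j ∸ x
    C = Z ⊛′ prefixWeight (suc j) (e ++ [ x ]) x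
    f : ℕ → Ser
    f y = when (winc ((e ++ [ x ]) ++ [ y ]) ∧ (h ≡ᵇ suc (suc j) ∸ y)) (prefixWeight (suc (suc j)) ((e ++ [ x ]) ++ [ y ]) y)
    ascend : ∀ s → f (x ℕ.+ s) ≋ when (h ≡ᵇ (suc (suc j) ∸ x) ∸ s) (C ⊛′ jump s)
    ascend s rewrite winc-extend e x (x ℕ.+ s) w | ≤ᵇ-true (ℕP.m≤m+n x s) | P.sym (ℕP.∸-+-assoc (suc (suc j)) x s)
      with h ≡ᵇ (suc (suc j) ∸ x) ∸ s
    ... | false = R.refl
    ... | true  = prefixWeight-extend j e x s w

  heightSeries : ℕ → ℕ → Ser
  heightSeries j h = overPrefixes j (λ e x →
    when (winc (e ++ [ x ]) ∧ (h ≡ᵇ suc j ∸ x)) (prefixWeight (suc j) (e ++ [ x ]) x))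

  -- the prefixes of length j+1, each followed by a strict ascent to height h
  -- (without the factor z of the ascent)
  ascentSeries : ℕ → ℕ → Ser
  ascentSeries j h = overPrefixes j (λ e x →
    when (winc (e ++ [ x ])) (prefixWeight (suc j) (e ++ [ x ]) x ⊛′ strictStep (suc j ∸ x) h))

  heightSeries-suc : ∀ j h₀ → heightSeries (suc j) (suc h₀) ≋ Z ⊛′ heightSeries j h₀ ⊕′ Z ⊛′ ascentSeries j (suc h₀)
  heightSeries-suc j h₀ = R.trans (SΣ.ΣI-suc j _)
    (R.trans (overPrefixes-cong j _ _ (λ e x x<1+j → R.trans (extend-prefix j e x (suc h₀) x<1+j) (step e x)))
             (overPrefixes-linear j Z Z _ _))
    where
    step : ∀ e x → let w = prefixWeight (suc j) (e ++ [ x ]) x ; he = suc j ∸ x in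
      when (winc (e ++ [ x ])) ((Z ⊛′ w) ⊛′ heightStep he (suc h₀))
        ≋ Z ⊛′ when (winc (e ++ [ x ]) ∧ (h₀ ≡ᵇ he)) w ⊕′ Z ⊛′ when (winc (e ++ [ x ])) (w ⊛′ strictStep he (suc h₀))
    step e x with winc (e ++ [ x ])
    ... | false = R.sym (R.trans (R.+-cong (R.zeroʳ Z) (R.zeroʳ Z)) (R.+-identityʳ _))
    ... | true  = begin
      (Z ⊛′ w) ⊛′ heightStep he (suc h₀)
        ≈⟨ R.*-cong R.refl (heightStep-split he h₀) ⟩
      (Z ⊛′ w) ⊛′ (when b 1ₛ ⊕′ strictStep he (suc h₀))
        ≈⟨ solve 4 (λ z w d s → (z :* w) :* (d :+ s) := z :* (w :* d) :+ z :* (w :* s))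
                 R.refl Z w (when b 1ₛ) (strictStep he (suc h₀)) ⟩
      Z ⊛′ (w ⊛′ when b 1ₛ) ⊕′ Z ⊛′ (w ⊛′ strictStep he (suc h₀))
        ≈⟨ R.+-cong (R.*-cong R.refl (when-1 b w)) R.refl ⟩
      Z ⊛′ when b w ⊕′ Z ⊛′ (w ⊛′ strictStep he (suc h₀)) ∎
      where
      w = prefixWeight (suc j) (e ++ [ x ]) x
      he = suc j ∸ x
      b = h₀ ≡ᵇ he

  ascentSeries-split : ∀ j h₀ → ascentSeries j (suc h₀) ≋ α ⊛′ heightSeries j (suc h₀) ⊕′ β ⊛′ ascentSeries j (suc (suc h₀))
  ascentSeries-split j h₀ = R.trans (overPrefixes-cong j _ _ (λ e x _ → step e x)) (overPrefixes-linear j α β _ _)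
    where
    step : ∀ e x → let w = prefixWeight (suc j) (e ++ [ x ]) x ; he = suc j ∸ x in
      when (winc (e ++ [ x ])) (w ⊛′ strictStep he (suc h₀))
        ≋ α ⊛′ when (winc (e ++ [ x ]) ∧ (suc h₀ ≡ᵇ he)) w ⊕′ β ⊛′ when (winc (e ++ [ x ])) (w ⊛′ strictStep he (suc (suc h₀)))
    step e x with winc (e ++ [ x ])
    ... | false = R.sym (R.trans (R.+-cong (R.zeroʳ α) (R.zeroʳ β)) (R.+-identityʳ _))
    ... | true  = begin
      w ⊛′ strictStep he (suc h₀)
        ≈⟨ R.*-cong R.refl (strictStep-split he h₀) ⟩
      w ⊛′ (α ⊛′ when b 1ₛ ⊕′ β ⊛′ strictStep he (suc (suc h₀)))
        ≈⟨ solve 5 (λ w a b d s → w :* (a :* d :+ b :* s) := a :* (w :* d) :+ b :* (w :* s))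
                 R.refl w α β (when b 1ₛ) (strictStep he (suc (suc h₀))) ⟩
      α ⊛′ (w ⊛′ when b 1ₛ) ⊕′ β ⊛′ (w ⊛′ strictStep he (suc (suc h₀)))
        ≈⟨ R.+-cong (R.*-cong R.refl (when-1 b w)) R.refl ⟩
      α ⊛′ when b w ⊕′ β ⊛′ (w ⊛′ strictStep he (suc (suc h₀))) ∎
      where
      w = prefixWeight (suc j) (e ++ [ x ]) x
      he = suc j ∸ x
      b = suc h₀ ≡ᵇ he

  -- the only prefix of length 1 is [ 0 ], of height 1 and weight z
  heightSeries-first : ∀ h → heightSeries 0 h ≋ when (h ≡ᵇ 1) Z
  heightSeries-first h = R.trans (R.+-identityʳ _) (R.trans (R.+-identityˡ _) (when-cong (h ≡ᵇ 1) weight))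
    where
    weight : prefixWeight 1 (0 ∷ []) 0 ≋ Z
    weight = R.trans (R.*-cong (R.*-identityʳ Z) (R.trans (R.*-cong S2.constant-1 R.refl) (R.*-identityˡ _))) (R.*-identityʳ Z)

  heightSeries-height0 : ∀ j → heightSeries j 0 ≋ 0ₛ
  heightSeries-height0 j = overPrefixes-zeroes j _ (λ e x x<1+j → when-false _ (positive e x x<1+j))
    where
    positive : ∀ e x → x < suc j → (winc (e ++ [ x ]) ∧ (0 ≡ᵇ suc j ∸ x)) ≡ false
    positive e x (s≤s x≤j) rewrite ℕP.+-∸-assoc 1 x≤j = BP.∧-zeroʳ _

  heightSeries-order : ∀ h j → HasOrder (suc j) (heightSeries j h)
  heightSeries-order h j = overPrefixes-order (suc j) j _ (λ e x → order (winc (e ++ [ x ]) ∧ (h ≡ᵇ suc j ∸ x)) e x)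
    where
    order : ∀ b e x → HasOrder (suc j) (when b (prefixWeight (suc j) (e ++ [ x ]) x))
    order true  e x = z^-order (suc j) _
    order false e x m _ = Q.refl

  ascentSeries-order : ∀ h j → HasOrder (suc j) (ascentSeries j h)
  ascentSeries-order h j = overPrefixes-order (suc j) j _ (λ e x → order (winc (e ++ [ x ])) e x)
    where
    order : ∀ b e x → HasOrder (suc j) (when b (prefixWeight (suc j) (e ++ [ x ]) x ⊛′ strictStep (suc j ∸ x) h))
    order true  e x m m<1+j =
      Q.trans (R.*-assoc (z^ (suc j)) _ (strictStep (suc j ∸ x) h) m) (z^-order (suc j) _ m m<1+j)
    order false e x m _ = Q.refl

  heightSeries-high : ∀ j h → suc j < h → heightSeries j h ≋ 0ₛ
  heightSeries-high j h 1+j<h = overPrefixes-zeroes j _ (λ e x _ → when-false _ (too-high e x))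
    where
    too-high : ∀ e x → (winc (e ++ [ x ]) ∧ (h ≡ᵇ suc j ∸ x)) ≡ false
    too-high e x rewrite >⇒≡ᵇ-false (ℕP.≤-<-trans (ℕP.m∸n≤m (suc j) x) 1+j<h) = BP.∧-zeroʳ _

  ascentSeries-high : ∀ j h → suc j < h → ascentSeries j h ≋ 0ₛ
  ascentSeries-high j h 1+j<h = overPrefixes-zeroes j _ (λ e x _ → vanish e x)
    where
    vanish : ∀ e x → when (winc (e ++ [ x ])) (prefixWeight (suc j) (e ++ [ x ]) x ⊛′ strictStep (suc j ∸ x) h) ≋ 0ₛ
    vanish e x rewrite ≤ᵇ-false (ℕP.≤-<-trans (ℕP.m∸n≤m (suc j) x) 1+j<h) | BP.∧-zeroʳ (1 ≤ᵇ h)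
      with winc (e ++ [ x ])
    ... | true  = R.zeroʳ _
    ... | false = R.refl

-- With N h = Σ_j heightSeries j h and
-- M h = Σ_j ascentSeries j h, the recursions above give
--   N (h+1) = [h = 0] z + z (N h + M (h+1)),   M (h+1) = α N (h+1) + β M (h+2).
-- We show N (h+2) = X N (h+1) and M (h+2) = X M (h+1) for X = N 1: the
-- differences satisfy the same linear recursions, and since M h = O(z^h)
-- they vanish, coefficient by coefficient.

module KernelMethod where
  open P using (refl)
  open Bivariate
  open Coefficients
  open PrefixExtension using (α; β)
  open HeightRecursion
  open import Algebra.Properties.Group (CommutativeRing.+-group ℤ⟦t,z⟧)
    using (x∙y⁻¹≈ε⇒x≈y)

  N : ℕ → Ser
  N h = Σ∞ (λ j → heightSeries j h)

  M : ℕ → Ser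
  M h = Σ∞ (λ j → ascentSeries j h)

  N-rec : ∀ h₀ → N (suc h₀) ≋ heightSeries 0 (suc h₀) ⊕′ Z ⊛′ (N h₀ ⊕′ M (suc h₀))
  N-rec h₀ zero = Q.sym (Q.trans (coeff-+ _ _ 0)
    (Q.trans (Q.+-cong (heightSeries-order (suc h₀) 0 0 (s≤s z≤n)) (coeff-z*-0 _)) (Q.+-identityʳ _)))
  N-rec h₀ (suc n) = begin
    N (suc h₀) (suc n)
      ≈⟨ S2.Σ-first n _ ⟩
    heightSeries 0 (suc h₀) (suc n) ⊞ S2.Σ n (λ j → heightSeries (suc j) (suc h₀) (suc n))
      ≈⟨ Q.+-cong Q.refl (S2.Σ-cong′ n (λ j →
           Q.trans (R.trans (heightSeries-suc j h₀) (R.sym (R.distribˡ Z _ _)) (suc n)) (coeff-z*-suc _ n))) ⟩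
    heightSeries 0 (suc h₀) (suc n) ⊞ Σ∞ (λ j → heightSeries j h₀ ⊕′ ascentSeries j (suc h₀)) n
      ≈⟨ Q.+-cong Q.refl (Σ∞-+ _ _ n) ⟩
    heightSeries 0 (suc h₀) (suc n) ⊞ (N h₀ ⊕′ M (suc h₀)) n
      ≈⟨ Q.+-cong Q.refl (Q.sym (coeff-z*-suc _ n)) ⟩
    heightSeries 0 (suc h₀) (suc n) ⊞ (Z ⊛′ (N h₀ ⊕′ M (suc h₀))) (suc n)
      ≈⟨ Q.sym (coeff-+ _ _ (suc n)) ⟩
    (heightSeries 0 (suc h₀) ⊕′ Z ⊛′ (N h₀ ⊕′ M (suc h₀))) (suc n) ∎
    where open import Relation.Binary.Reasoning.Setoid Q.setoid

  M-rec : ∀ h₀ → M (suc h₀) ≋ α ⊛′ N (suc h₀) ⊕′ β ⊛′ M (suc (suc h₀))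
  M-rec h₀ = R.trans (Σ∞-cong _ _ (λ j → ascentSeries-split j h₀))
    (R.trans (Σ∞-+ _ _) (R.+-cong (Σ∞-*ˡ α _ (heightSeries-order (suc h₀)))
                                  (Σ∞-*ˡ β _ (ascentSeries-order (suc (suc h₀))))))

  -- no prefix has height 0, and N h, M h = O(zʰ) since a prefix is at least
  -- as long as its height
  N-0 : N 0 ≋ 0ₛ
  N-0 n = S2.Σ-zeroes n (λ j _ → heightSeries-height0 j n)

  N-order : ∀ h → HasOrder h (N h)
  N-order h m m<h = S2.Σ-zeroes m (λ j j<m → heightSeries-high j h (ℕP.<-≤-trans (s≤s j<m) m<h) m)

  M-order : ∀ h → HasOrder h (M h)
  M-order h m m<h = S2.Σ-zeroes m (λ j j<m → ascentSeries-high j h (ℕP.<-≤-trans (s≤s j<m) m<h) m)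

  X : Ser
  X = N 1

  V : Ser
  V = M 1

  -- the only prefix of height 1 without a predecessor is [ 0 ]
  X-eq : X ≋ Z ⊕′ Z ⊛′ V
  X-eq = R.trans (N-rec 0) (R.+-cong (heightSeries-first 1) (R.*-cong R.refl (R.trans (R.+-cong N-0 R.refl) (R.+-identityˡ _))))

  N-rec₂ : ∀ h → N (suc (suc h)) ≋ Z ⊛′ (N (suc h) ⊕′ M (suc (suc h)))
  N-rec₂ h = R.trans (N-rec (suc h)) (R.trans (R.+-cong (heightSeries-first (suc (suc h))) R.refl) (R.+-identityˡ _))

  ΔN : ℕ → Ser
  ΔN h = N (suc (suc h)) ⊕′ ⊝ (X ⊛′ N (suc h))

  ΔM : ℕ → Ser
  ΔM h = M (suc (suc h)) ⊕′ ⊝ (X ⊛′ M (suc h))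

  ΔN-0 : ΔN 0 ≋ Z ⊛′ ΔM 0
  ΔN-0 = R.trans (R.+-cong (N-rec₂ 0) (R.-‿cong (R.*-cong R.refl X-eq)))
    (solve 4 (λ z x m₂ v → z :* (x :+ m₂) :+ :- (x :* (z :+ z :* v)) := z :* (m₂ :+ :- (x :* v))) R.refl Z X (M 2) V)

  ΔN-suc : ∀ h → ΔN (suc h) ≋ Z ⊛′ ΔN h ⊕′ Z ⊛′ ΔM (suc h)
  ΔN-suc h = R.trans (R.+-cong (N-rec₂ (suc h)) (R.-‿cong (R.*-cong R.refl (N-rec₂ h))))
    (solve 6 (λ z x n₂ n₁ m₃ m₂ → z :* (n₂ :+ m₃) :+ :- (x :* (z :* (n₁ :+ m₂)))
                                  := z :* (n₂ :+ :- (x :* n₁)) :+ z :* (m₃ :+ :- (x :* m₂)))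
       R.refl Z X (N (suc (suc h))) (N (suc h)) (M (suc (suc (suc h)))) (M (suc (suc h))))

  ΔM-rec : ∀ h → ΔM h ≋ α ⊛′ ΔN h ⊕′ β ⊛′ ΔM (suc h)
  ΔM-rec h = R.trans (R.+-cong (M-rec (suc h)) (R.-‿cong (R.*-cong R.refl (M-rec h))))
    (solve 7 (λ a b x n₂ n₁ m₃ m₂ → a :* n₂ :+ b :* m₃ :+ :- (x :* (a :* n₁ :+ b :* m₂))
                                    := a :* (n₂ :+ :- (x :* n₁)) :+ b :* (m₃ :+ :- (x :* m₂)))
       R.refl α β X (N (suc (suc h))) (N (suc h)) (M (suc (suc (suc h)))) (M (suc (suc h))))

  ΔM-order : ∀ h → HasOrder (suc (suc h)) (ΔM h)
  ΔM-order h m m<2+h = Q.trans (coeff-+ _ _ m) (Q.trans (Q.+-cong (M-order (suc (suc h)) m m<2+h)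
    (Q.trans (coeff-⊝ _ m) (Q.trans (Q.-‿cong (order-* X (M (suc h)) (N-order 1) (M-order (suc h)) m m<2+h)) (-0≈0 Q.ring))))
    (Q.+-identityʳ _))
    where open import Algebra.Properties.Ring using () renaming (-0#≈0# to -0≈0)

  coeff-z*-vanish : ∀ A n → HasOrder n A → (Z ⊛′ A) n ≈₁ 0#
  coeff-z*-vanish A zero    hA = coeff-z*-0 A
  coeff-z*-vanish A (suc n) hA = Q.trans (coeff-z*-suc A n) (hA n (ℕP.n<1+n n))

  Vanish : ℕ → Set
  Vanish n = ∀ h m → m < n → (ΔN h m ≈₁ 0#) × (ΔM h m ≈₁ 0#)

  -- if all defects vanish below n, they vanish at n: first ΔN via the z-shifted
  -- recursion, then ΔM by iterating ΔM h = α ΔN h + β ΔM (h+1) until the order wins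
  vanish-step : ∀ n → Vanish n → ∀ h → (ΔN h n ≈₁ 0#) × (ΔM h n ≈₁ 0#)
  vanish-step n IH h = ΔN-vanish h , ΔM-vanish h
    where
    IH-N : ∀ h → HasOrder n (ΔN h)
    IH-N h m m<n = proj₁ (IH h m m<n)
    IH-M : ∀ h → HasOrder n (ΔM h)
    IH-M h m m<n = proj₂ (IH h m m<n)
    ΔN-vanish : ∀ h → ΔN h n ≈₁ 0#
    ΔN-vanish zero    = Q.trans (ΔN-0 n) (coeff-z*-vanish _ n (IH-M 0))
    ΔN-vanish (suc h) = Q.trans (ΔN-suc h n) (Q.trans (coeff-+ _ _ n)
      (Q.trans (Q.+-cong (coeff-z*-vanish _ n (IH-N h)) (coeff-z*-vanish _ n (IH-M (suc h)))) (Q.+-identityʳ _)))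
    ΔN-upto : ∀ h → HasOrder (suc n) (ΔN h)
    ΔN-upto h m m≤n with ℕP.m≤n⇒m<n∨m≡n (ℕP.≤-pred m≤n)
    ... | inj₁ m<n  = IH-N h m m<n
    ... | inj₂ refl = ΔN-vanish h
    ΔM-step : ∀ h → ΔM h n ≈₁ β 0 ⊠ ΔM (suc h) n
    ΔM-step h = Q.trans (ΔM-rec h n) (Q.trans (coeff-+ _ _ n)
      (Q.trans (Q.+-cong (coeff-*-zero α (ΔN h) n (ΔN-upto h)) (coeff-*-lead β (ΔM (suc h)) n (IH-M (suc h))))
               (Q.+-identityˡ _)))
    iterate : ∀ d h → n ≤ d ℕ.+ h → ΔM h n ≈₁ 0#
    iterate zero    h n≤h = ΔM-order h n (ℕP.m≤n⇒m≤1+n (s≤s n≤h))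
    iterate (suc d) h n≤1+d+h = Q.trans (ΔM-step h)
      (Q.trans (Q.*-cong Q.refl (iterate d (suc h) (ℕP.≤-trans n≤1+d+h (ℕP.≤-reflexive (P.sym (ℕP.+-suc d h)))))) (Q.zeroʳ _))
    ΔM-vanish : ∀ h → ΔM h n ≈₁ 0#
    ΔM-vanish h = iterate n h (ℕP.m≤m+n n h)

  vanish : ∀ n → Vanish n
  vanish zero    h m ()
  vanish (suc n) h m m<1+n with ℕP.m≤n⇒m<n∨m≡n (ℕP.≤-pred m<1+n)
  ... | inj₁ m<n  = vanish n h m m<n
  ... | inj₂ refl = vanish-step n (vanish n) h

  N-shift : ∀ h → N (suc (suc h)) ≋ X ⊛′ N (suc h)
  N-shift h = x∙y⁻¹≈ε⇒x≈y _ _ (λ m → proj₁ (vanish (suc m) h m (ℕP.n<1+n m)))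

  M-shift : ∀ h → M (suc (suc h)) ≋ X ⊛′ M (suc h)
  M-shift h = x∙y⁻¹≈ε⇒x≈y _ _ (λ m → proj₂ (vanish (suc m) h m (ℕP.n<1+n m)))

  V-eq : V ≋ α ⊛′ X ⊕′ β ⊛′ (X ⊛′ V)
  V-eq = R.trans (M-rec 0) (R.+-cong R.refl (R.*-cong R.refl (M-shift 0)))

module AllHeights where
  open P using (refl)
  open Bivariate
  open Coefficients
  open Sequences using (winc)
  open PrefixSeries
  open HeightRecursion using (heightSeries; overPrefixes-coeff)
  open KernelMethod
  open SΣ using () renaming (when to whenₛ)
  open import Relation.Binary.Reasoning.Setoid Q.setoid

  B : Ser
  B = Σ∞ (λ h → N (suc h))

  -- B = N 1 + Σ_h N (h+2) = X + X B
  B-eq : B ≋ X ⊕′ X ⊛′ B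
  B-eq = R.trans shift (R.+-cong R.refl (Σ∞-*ˡ X _ (λ j → N-order (suc j))))
    where
    shift : B ≋ X ⊕′ Σ∞ (λ h → X ⊛′ N (suc h))
    shift zero    = Q.sym (Q.trans (coeff-+ X _ 0) (Q.trans (Q.+-cong (N-order 1 0 (s≤s z≤n)) Q.refl) (Q.+-identityʳ _)))
    shift (suc n) = begin
      B (suc n)
        ≈⟨ S2.Σ-first n _ ⟩
      X (suc n) ⊞ S2.Σ n (λ h → N (suc (suc h)) (suc n))
        ≈⟨ Q.+-cong Q.refl (S2.Σ-cong′ n (λ h → N-shift h (suc n))) ⟩
      X (suc n) ⊞ S2.Σ n (λ h → (X ⊛′ N (suc h)) (suc n))
        ≈⟨ Q.+-cong Q.refl (Q.sym (Q.trans (Q.+-cong Q.refl last) (Q.+-identityʳ _))) ⟩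
      X (suc n) ⊞ Σ∞ (λ h → X ⊛′ N (suc h)) (suc n)
        ≈⟨ Q.sym (coeff-+ X _ (suc n)) ⟩
      (X ⊕′ Σ∞ (λ h → X ⊛′ N (suc h))) (suc n) ∎
      where
      last : (X ⊛′ N (suc n)) (suc n) ≈₁ 0#
      last = order-* X (N (suc n)) (N-order 1) (N-order (suc n)) (suc n) (ℕP.n<1+n (suc n))

  when-∧ : ∀ w c (A : Ser) n → whenₛ (w ∧ c) A n ≡ S2.when c (whenₛ w A n)
  when-∧ true  true  A n = refl
  when-∧ true  false A n = refl
  when-∧ false true  A n = refl
  when-∧ false false A n = refl

  prefixSeries-heights : ∀ j n → j < n → S2.Σ n (λ h → heightSeries j (suc h) n) ≈₁ prefixSeries j n
  prefixSeries-heights j n j<n = begin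
    S2.Σ n (λ h → heightSeries j (suc h) n)
      ≈⟨ S2.Σ-cong′ n (λ h → overPrefixes-coeff j _ n) ⟩
    S2.Σ n (λ h → S2.ΣL (I j) (λ e → S2.Σ (suc j) (λ x → term h e x)))
      ≈⟨ S2.Σ-ΣL n (I j) _ ⟩
    S2.ΣL (I j) (λ e → S2.Σ n (λ h → S2.Σ (suc j) (λ x → term h e x)))
      ≈⟨ S2.ΣL-cong (I j) (λ e → Q.trans (S2.Σ-swap n (suc j) _) (S2.Σ-cong (suc j) (one-height e))) ⟩
    S2.ΣL (I j) (λ e → S2.Σ (suc j) (λ x → whenₛ (winc (e ++ [ x ])) (prefixWeight (suc j) (e ++ [ x ]) x) n))
      ≈⟨ Q.sym (overPrefixes-coeff j _ n) ⟩
    prefixSeries j n ∎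
    where
    term : ℕ → List ℕ → ℕ → Q.Carrier
    term h e x = whenₛ (winc (e ++ [ x ]) ∧ (suc h ≡ᵇ suc j ∸ x)) (prefixWeight (suc j) (e ++ [ x ]) x) n
    one-height : ∀ e x → x < suc j →
      S2.Σ n (λ h → term h e x) ≈₁ whenₛ (winc (e ++ [ x ])) (prefixWeight (suc j) (e ++ [ x ]) x) n
    one-height e x (s≤s x≤j) rewrite ℕP.+-∸-assoc 1 x≤j =
      Q.trans (S2.Σ-cong′ n (λ h → Q.reflexive (when-∧ (winc (e ++ [ x ])) (h ≡ᵇ j ∸ x) _ n)))
              (Q.trans (S2.Σ-delta n (j ∸ x) _) (S2.when-true _ (<ᵇ-true (ℕP.≤-<-trans (ℕP.m∸n≤m j x) j<n))))

  prefixes-by-height : Σ∞ prefixSeries ≋ B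
  prefixes-by-height n =
    Q.sym (Q.trans (S2.Σ-swap n n _) (S2.Σ-cong n (λ j j<n → prefixSeries-heights j n j<n)))

  F-B : F ≋ 1ₛ ⊕′ T₂ ⊛′ B
  F-B = R.trans F-prefixes (R.+-cong R.refl (R.*-cong R.refl prefixes-by-height))

module Elimination where
  open P using (refl)
  open Bivariate
  open PrefixExtension using (α; β)
  open KernelMethod using (X; V; X-eq; V-eq)
  open AllHeights using (B; B-eq; F-B)
  open import Algebra.Properties.Group (CommutativeRing.+-group ℤ⟦t,z⟧) using (x≈y⇒x∙y⁻¹≈ε)

  infixl 6 _⊖′_
  _⊖′_ : Ser → Ser → Ser
  A ⊖′ C = A ⊕′ ⊝ C

  k : ℕ → Ser
  k n = const (+ n)

  -- α and β with the unit written as an integer constant, as the solver needs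
  α≋ : α ≋ T₂ ⊛′ (k 1 ⊕′ Z)
  α≋ = R.*-cong R.refl (R.+-cong 1≋const R.refl)

  β≋ : β ≋ k 1 ⊕′ Z ⊛′ T₂
  β≋ = R.+-cong 1≋const R.refl

  combination-zero : ∀ {P E₁ E₂} C₁ C₂ → P ≋ C₁ ⊛′ E₁ ⊕′ C₂ ⊛′ E₂ → E₁ ≋ 0ₛ → E₂ ≋ 0ₛ → P ≋ 0ₛ
  combination-zero C₁ C₂ P≋ E₁≋0 E₂≋0 = R.trans P≋ (R.trans
    (R.+-cong (R.trans (R.*-cong R.refl E₁≋0) (R.zeroʳ C₁)) (R.trans (R.*-cong R.refl E₂≋0) (R.zeroʳ C₂)))
    (R.+-identityʳ _))

  X-quadratic : X ⊖′ Z ⊖′ Z ⊛′ (T₂ ⊖′ k 1) ⊛′ X ⊖′ (k 1 ⊕′ Z ⊛′ T₂) ⊛′ (X ⊛′ X) ≋ 0ₛ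
  X-quadratic = combination-zero (k 1 ⊖′ (k 1 ⊕′ Z ⊛′ T₂) ⊛′ X) Z
    (solve 4 (λ x z t v →
       x :- z :- z :* (t :- con (+ 1)) :* x :- (con (+ 1) :+ z :* t) :* (x :* x)
       := (con (+ 1) :- (con (+ 1) :+ z :* t) :* x) :* (x :- (z :+ z :* v))
          :+ z :* (v :- (t :* (con (+ 1) :+ z) :* x :+ (con (+ 1) :+ z :* t) :* (x :* v))))
       R.refl X Z T₂ V)
    (x≈y⇒x∙y⁻¹≈ε X-eq)
    (x≈y⇒x∙y⁻¹≈ε (R.trans V-eq (R.+-cong (R.*-cong α≋ R.refl) (R.*-cong β≋ R.refl))))

  B-quadratic : B ⊖′ Z ⊖′ Z ⊛′ (k 1 ⊕′ T₂) ⊛′ B ⊖′ k 2 ⊛′ Z ⊛′ T₂ ⊛′ (B ⊛′ B) ≋ 0ₛ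
  B-quadratic = combination-zero ((k 1 ⊕′ B) ⊛′ (k 1 ⊕′ B)) (⊝ cofactor)
    (solve 4 (λ b x z t →
       b :- z :- z :* (con (+ 1) :+ t) :* b :- con (+ 2) :* z :* t :* (b :* b)
       := (con (+ 1) :+ b) :* (con (+ 1) :+ b) :* (x :- z :- z :* (t :- con (+ 1)) :* x :- (con (+ 1) :+ z :* t) :* (x :* x))
          :+ (:- (:- (con (+ 1) :+ b) :+ z :* (t :- con (+ 1)) :* (con (+ 1) :+ b)
                 :+ con (+ 2) :* (con (+ 1) :+ z :* t) :* b :- (con (+ 1) :+ z :* t) :* (b :- (x :+ x :* b))))
             :* (b :- (x :+ x :* b)))
       R.refl B X Z T₂)
    X-quadratic
    (x≈y⇒x∙y⁻¹≈ε B-eq)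
    where
    cofactor : Ser
    cofactor = ⊝ (k 1 ⊕′ B) ⊕′ Z ⊛′ (T₂ ⊖′ k 1) ⊛′ (k 1 ⊕′ B) ⊕′ k 2 ⊛′ (k 1 ⊕′ Z ⊛′ T₂) ⊛′ B
               ⊖′ (k 1 ⊕′ Z ⊛′ T₂) ⊛′ (B ⊖′ (X ⊕′ X ⊛′ B))

  Num≈ : Num ≈ˢ k 1 ⊕′ Z ⊛′ (k 3 ⊖′ T₂)
  Num≈ = R.trans (⊕≈ _ _) (R.+-cong R.refl
    (R.trans (⊛≈ _ _) (R.*-cong zS≈ (R.trans (⊖≈ _ _) (R.+-cong R.refl (R.-‿cong tS≈))))))

  RadR : Ser
  RadR = k 1 ⊖′ Z ⊛′ (k 2 ⊕′ k 2 ⊛′ T₂ ⊖′ Z ⊕′ k 6 ⊛′ Z ⊛′ T₂ ⊖′ Z ⊛′ T₂ ⊛′ T₂)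

  Rad≈ : Rad ≈ˢ RadR
  Rad≈ = R.trans (⊖≈ _ _) (R.+-cong R.refl (R.-‿cong (R.trans (⊛≈ _ _) (R.*-cong zS≈ radicand))))
    where
    radicand : const (+ 2) ⊕ const (+ 2) ⊛ tS ⊖ zS ⊕ const (+ 6) ⊛ zS ⊛ tS ⊖ zS ⊛ tS ⊛ tS
               ≈ˢ k 2 ⊕′ k 2 ⊛′ T₂ ⊖′ Z ⊕′ k 6 ⊛′ Z ⊛′ T₂ ⊖′ Z ⊛′ T₂ ⊛′ T₂
    radicand = R.trans (⊖≈ _ _) (R.+-cong
      (R.trans (⊕≈ _ _) (R.+-cong
        (R.trans (⊖≈ _ _) (R.+-cong (R.trans (⊕≈ _ _) (R.+-cong R.refl (R.trans (⊛≈ _ _) (R.*-cong R.refl tS≈)))) (R.-‿cong zS≈)))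
        (R.trans (⊛≈ _ _) (R.*-cong (R.trans (⊛≈ _ _) (R.*-cong R.refl zS≈)) tS≈))))
      (R.-‿cong (R.trans (⊛≈ _ _) (R.*-cong (R.trans (⊛≈ _ _) (R.*-cong zS≈ tS≈)) tS≈))))

  root : Ser
  root = Num ⊖ const (+ 4) ⊛ zS ⊛ F

  root-constant : root 0 0 ≡ + 1
  root-constant = refl

  root≈ : root ≈ˢ (k 1 ⊕′ Z ⊛′ (k 3 ⊖′ T₂)) ⊖′ k 4 ⊛′ Z ⊛′ (k 1 ⊕′ T₂ ⊛′ B)
  root≈ = R.trans (⊖≈ _ _) (R.+-cong Num≈ (R.-‿cong
    (R.trans (⊛≈ _ _) (R.*-cong (R.trans (⊛≈ _ _) (R.*-cong R.refl zS≈)) (R.trans F-B (R.+-cong 1≋const R.refl))))))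

  -- its square is Rad + (-8zt)·(B-quadratic) = Rad
  root-squared : root ⊛′ root ≋ Rad
  root-squared = R.trans (R.*-cong root≈ root≈) (R.trans
    (solve 3 (λ z t b →
       let r = (con (+ 1) :+ z :* (con (+ 3) :- t)) :- con (+ 4) :* z :* (con (+ 1) :+ t :* b) in
       r :* r := (con (+ 1) :- z :* (con (+ 2) :+ con (+ 2) :* t :- z :+ con (+ 6) :* z :* t :- z :* t :* t))
                 :+ (con (-[1+ 7 ]) :* z :* t) :* (b :- z :- z :* (con (+ 1) :+ t) :* b :- con (+ 2) :* z :* t :* (b :* b)))
       R.refl Z T₂ B)
    (R.trans (R.+-cong R.refl (R.trans (R.*-cong R.refl B-quadratic) (R.zeroʳ _)))
             (R.trans (R.+-identityʳ _) (R.sym Rad≈))))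

open Bivariate using (module R; _⊕′_; ⊝_; _⊛′_; ⊖≈; ⊛≈; solve; _:-_; _:=_)
open SquareRoots using (sqrt-unique)
open Elimination using (root; root-constant; root-squared)

theorem4p21 : (S : Ser) → S ⊛ S ≈ˢ Rad → S 0 0 ≡ + 1 →
    const (+ 4) ⊛ zS ⊛ F ≈ˢ Num ⊖ S
theorem4p21 S S²≈Rad S₀₀ = R.sym (begin
  Num ⊖ S                      ≈⟨ ⊖≈ Num S ⟩
  Num ⊕′ ⊝ S                   ≈⟨ R.+-cong R.refl (R.-‿cong S≋root) ⟩
  Num ⊕′ ⊝ root                ≈⟨ R.+-cong R.refl (R.-‿cong (⊖≈ Num W)) ⟩
  Num ⊕′ ⊝ (Num ⊕′ ⊝ W)        ≈⟨ solve 2 (λ n w → n :- (n :- w) := w) R.refl Num W ⟩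
  W                            ∎)
  where
  open import Relation.Binary.Reasoning.Setoid R.setoid
  W : Ser
  W = const (+ 4) ⊛ zS ⊛ F
  S≋root : S ≈ˢ root
  S≋root = sqrt-unique S root (R.trans (R.sym (⊛≈ S S)) (R.trans S²≈Rad (R.sym root-squared))) S₀₀ root-constant
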